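{- Let $p>3$ be a prime and let $b$ be any integer. For integers $a$ and $b$ define $$N_p(a,b):=\left|\left\{x\in\mathbb Z:\ 1\le x\le \tfrac{p-1}2,\ \{x^2+b\}_p>\{ax^2+b\}_p\right\}\right|,$$ where $\{m\}_p$ denotes the least nonnegative residue of the integer $m$ modulo $p$. Set $$S=\left\{N_p(a,b):\ a\in\mathbb Z,\ 1<a<p,\ \left(\frac ap\right)=1\right\}$$ and $$T=\left\{N_p(a,b):\ a\in\mathbb Z,\ 1<a<p,\ \left(\frac ap\right)=-1\right\}.$$ Then $|S|=|T|=1$ if $p\equiv1\pmod4$, and $|S|=|T|=2$ if $p\equiv3\pmod4$. Moreover, the set $S$ does not depend on the value of $b$.
   Context: $\left(\frac{\cdot}{p}\right)$ denotes the Legendre symbol modulo the odd prime $p$. For an integer $m$, $\{m\}_p\in\{0,1,\ldots,p-1\}$ is the least nonnegative residue of $m$ modulo $p$. -}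

module Defs where

open import Data.Nat as ℕ using (ℕ; zero; suc; _∸_; _<?_)
open import Relation.Binary.PropositionalEquality using (_≡_; _≢_)
open import Data.Sum using (_⊎_)
open import Data.Integer as ℤ using (ℤ; +_; _%ℕ_)
open import Data.List using (List; map; upTo; filter; length)
open import Data.Bool.ListAction using (any)
open import Data.Bool using (if_then_else_)
open import Data.Product using (Σ; ∃; _×_)

-- least nonnegative residue {m}_p of an integer m modulo p (p > 0);
-- for p = 0 (never used) we return 0 by convention.
res : ℤ → ℕ → ℕ
res m zero    = 0
res m (suc k) = m %ℕ suc k

legendre : ℤ → ℕ → ℤ
legendre a p =
  if res a p ℕ.≡ᵇ 0 then + 0
  else if any (λ x → res (+ (x ℕ.* x)) p ℕ.≡ᵇ res a p) (upTo p) then + 1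
  else ℤ.-[1+ 0 ]

Np : ℕ → ℤ → ℤ → ℕ
Np p a b = length (filter (λ x → res (a ℤ.* (+ (x ℕ.* x)) ℤ.+ b) p <? res (+ (x ℕ.* x) ℤ.+ b) p)
                          (map suc (upTo ((p ∸ 1) ℕ./ 2))))

InSet : ℕ → ℤ → ℤ → ℕ → Set
InSet p ε b n = ∃ λ (a : ℤ) → (+ 1 ℤ.< a) × (a ℤ.< + p) × (legendre a p ≡ ε) × (Np p a b ≡ n)

HasExactly1 : (ℕ → Set) → Set
HasExactly1 P = ∃ λ v → P v × (∀ n → P n → n ≡ v)

HasExactly2 : (ℕ → Set) → Set
HasExactly2 P = ∃ λ v → ∃ λ w → v ≢ w × P v × P w × (∀ n → P n → n ≡ v ⊎ n ≡ w)

{-# OPTIONS --safe #-}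
module Submission where

open import Defs
open import Data.Nat using (ℕ; _>_; _%_)
open import Data.Nat.Primality using (Prime)
open import Data.Integer using (ℤ; +_; -[1+_])
open import Data.Product using (_×_)
open import Relation.Binary.PropositionalEquality using (_≡_)

open import Data.Nat using (zero; suc; _+_; _*_; _∸_; _≤_; _<_; z≤n; s≤s; _≡ᵇ_; _<ᵇ_; _<?_; _≤?_; _≟_; _/_; NonZero; ≢-nonZero; nonTrivial⇒n>1)
open import Data.Nat.Properties
open import Data.Nat.DivMod
open import Data.Nat.Divisibility using (m%n≡0⇒n∣m; n∣m⇒m%n≡0)
open import Data.Nat.Primality using (prime⇒irreducible; euclidsLemma; prime⇒nonTrivial)
open import Data.Nat.Coprimality using (prime⇒coprime; coprime-Bézout)
open import Data.Nat.GCD using (module Bézout)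
open import Data.Nat.Tactic.RingSolver using (solve-∀)
open import Data.Bool using (Bool; true; false; _∧_; _∨_; not; T; if_then_else_)
open import Data.Bool.Properties using (∨-zeroʳ; ∧-zeroʳ; not-injective; not-involutive; ¬-not; not-¬; ⇔→≡)
open import Data.Bool.ListAction using (any)
open import Data.Integer as ℤ using (_%ℕ_; _⊖_)
open import Data.Integer.Properties using (pos-*; ⊖-≥; ⊖-<)
open import Data.Integer.DivMod using (n%ℕd<d)
open import Data.List using (applyUpTo; upTo; filter; length)
open import Data.List.Properties using (map-applyUpTo)
open import Data.Product using (∃; _,_; proj₁; proj₂)
open import Data.Sum using (_⊎_; inj₁; inj₂)
open import Data.Empty using (⊥; ⊥-elim)
open import Function using (_∘_; id)
open import Function.Bundles using (_⇔_; mk⇔; Equivalence)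
open import Relation.Nullary using (¬_; yes; no; does)
open import Relation.Unary using (Decidable)
open import Relation.Binary.PropositionalEquality

-- Let n = (p − 1)/2 and, for 1 < k < p and 1 ≤ x ≤ n, put A = {kx² + b}, B = {x² + b} and
-- C = {(1 − k)x²}. As A + C ≡ B (mod p) and 0 < C < p, we have B + p·[A ≥ B] = A + C, and
-- summing over x gives  Σ B + p·(n − N_p(k,b)) = Σ A + Σ C.
-- The squares x² (1 ≤ x ≤ n) are the n quadratic residues, each met once, and multiplication
-- by k maps them onto the residues or onto the non-residues according to (k/p). So Σ A depends
-- only on (k/p), and equals Σ B when (k/p) = 1, in which case N_p(k,b) does not depend on b;
-- and Σ C is the sum R of the residues or the sum R′ of the non-residues according to
-- ((1 − k)/p). Hence N_p(k,b) is determined by (k/p) and, if R ≠ R′, by ((1 − k)/p).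
-- Pairing every residue t ≠ ±1 with t⁻¹ shows that −1 is a residue iff n is even. For
-- p ≡ 1 (mod 4) the residues are then closed under t ↦ p − t, so 2R = pn = R + R′ and R = R′.
-- For p ≡ 3 (mod 4), R + R′ = pn is odd, so R ≠ R′; and since ((1 − k)/p) = −((k − 1)/p),
-- the places where (·/p) changes value between consecutive integers supply, for each value
-- of (k/p), values of k with both values of ((1 − k)/p).

-- Sums and counts over initial segments of ℕ

Σ< : ℕ → (ℕ → ℕ) → ℕ
Σ< zero    f = 0
Σ< (suc m) f = f 0 + Σ< m (λ i → f (suc i))

any< : ℕ → (ℕ → Bool) → Bool
any< zero    P = false
any< (suc m) P = P 0 ∨ any< m (λ i → P (suc i))

⟦_⟧ : Bool → ℕ
⟦ true  ⟧ = 1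
⟦ false ⟧ = 0

count : ℕ → (ℕ → Bool) → ℕ
count m P = Σ< m (λ i → ⟦ P i ⟧)

image : ℕ → (ℕ → Bool) → (ℕ → ℕ) → ℕ → Bool
image m D h t = any< m (λ i → D i ∧ (h i ≡ᵇ t))

Pointwise< : ℕ → (ℕ → ℕ) → (ℕ → ℕ) → Set
Pointwise< m f g = ∀ i → i < m → f i ≡ g i

∧-true : ∀ {a b} → (a ∧ b) ≡ true → a ≡ true × b ≡ true
∧-true {true} e = refl , e

≡ᵇ-true : ∀ {m n} → (m ≡ᵇ n) ≡ true → m ≡ n
≡ᵇ-true {m} {n} e = ≡ᵇ⇒≡ m n (subst T (sym e) _)

≡⇒≡ᵇ-true : ∀ {m n} → m ≡ n → (m ≡ᵇ n) ≡ true
≡⇒≡ᵇ-true {zero}  refl = refl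
≡⇒≡ᵇ-true {suc m} refl = ≡⇒≡ᵇ-true {m} refl

≢⇒≡ᵇ-false : ∀ {m n} → m ≢ n → (m ≡ᵇ n) ≡ false
≢⇒≡ᵇ-false ne = ¬-not (ne ∘ ≡ᵇ-true)

≡ᵇ-false⇒≢ : ∀ {m n} → (m ≡ᵇ n) ≡ false → m ≢ n
≡ᵇ-false⇒≢ e m≡n = not-¬ (≡⇒≡ᵇ-true m≡n) e

<ᵇ-true : ∀ {m n} → (m <ᵇ n) ≡ true → m < n
<ᵇ-true {m} {n} e = <ᵇ⇒< m n (subst T (sym e) _)

<⇒<ᵇ-true : ∀ {m n} → m < n → (m <ᵇ n) ≡ true
<⇒<ᵇ-true {m} {n} lt with m <ᵇ n | <⇒<ᵇ lt
... | true | _ = refl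

≮⇒<ᵇ-false : ∀ {m n} → ¬ m < n → (m <ᵇ n) ≡ false
≮⇒<ᵇ-false nlt = ¬-not (nlt ∘ <ᵇ-true)

Σ<-cong : ∀ m {f g} → Pointwise< m f g → Σ< m f ≡ Σ< m g
Σ<-cong zero    _ = refl
Σ<-cong (suc m) h = cong₂ _+_ (h 0 (s≤s z≤n)) (Σ<-cong m (λ i i<m → h (suc i) (s≤s i<m)))

Σ<-+ : ∀ m f g → Σ< m (λ i → f i + g i) ≡ Σ< m f + Σ< m g
Σ<-+ zero    f g = refl
Σ<-+ (suc m) f g = begin
  (f 0 + g 0) + Σ< m (λ i → f (suc i) + g (suc i))
    ≡⟨ cong (_+_ (f 0 + g 0)) (Σ<-+ m (λ i → f (suc i)) (λ i → g (suc i))) ⟩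
  (f 0 + g 0) + (Σ< m (λ i → f (suc i)) + Σ< m (λ i → g (suc i)))
    ≡⟨ interchange (f 0) (g 0) _ _ ⟩
  (f 0 + Σ< m (λ i → f (suc i))) + (g 0 + Σ< m (λ i → g (suc i))) ∎
  where
  open ≡-Reasoning
  interchange : ∀ a b c d → (a + b) + (c + d) ≡ (a + c) + (b + d)
  interchange = solve-∀

Σ<-*ˡ : ∀ m c f → Σ< m (λ i → c * f i) ≡ c * Σ< m f
Σ<-*ˡ zero    c f = sym (*-zeroʳ c)
Σ<-*ˡ (suc m) c f = trans (cong (_+_ (c * f 0)) (Σ<-*ˡ m c (λ i → f (suc i)))) (sym (*-distribˡ-+ c (f 0) _))

Σ<-const : ∀ m c → Σ< m (λ _ → c) ≡ m * c
Σ<-const zero    c = refl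
Σ<-const (suc m) c = cong (_+_ c) (Σ<-const m c)

Σ<-zero : ∀ m {f} → Pointwise< m f (λ _ → 0) → Σ< m f ≡ 0
Σ<-zero m h = trans (Σ<-cong m h) (trans (Σ<-const m 0) (*-zeroʳ m))

Σ<-snoc : ∀ m f → Σ< (suc m) f ≡ Σ< m f + f m
Σ<-snoc zero    f = +-comm (f 0) 0
Σ<-snoc (suc m) f = trans (cong (_+_ (f 0)) (Σ<-snoc m (λ i → f (suc i)))) (sym (+-assoc (f 0) _ _))

Σ<-swap : ∀ m M (F : ℕ → ℕ → ℕ) → Σ< m (λ i → Σ< M (F i)) ≡ Σ< M (λ t → Σ< m (λ i → F i t))
Σ<-swap zero    M F = sym (Σ<-zero M (λ _ _ → refl))
Σ<-swap (suc m) M F = trans (cong (_+_ (Σ< M (F 0))) (Σ<-swap m M (λ i → F (suc i))))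
                            (sym (Σ<-+ M (F 0) (λ t → Σ< m (λ i → F (suc i) t))))

Σ<-δ : ∀ M g u → u < M → Σ< M (λ t → g t * ⟦ u ≡ᵇ t ⟧) ≡ g u
Σ<-δ (suc M) g zero    _ = begin
  g 0 * 1 + Σ< M (λ t → g (suc t) * 0) ≡⟨ cong₂ _+_ (*-identityʳ (g 0)) (Σ<-zero M (λ t _ → *-zeroʳ (g (suc t)))) ⟩
  g 0 + 0                              ≡⟨ +-identityʳ (g 0) ⟩
  g 0                                  ∎
  where open ≡-Reasoning
Σ<-δ (suc M) g (suc u) (s≤s u<M) = begin
  g 0 * 0 + Σ< M (λ t → g (suc t) * ⟦ u ≡ᵇ t ⟧) ≡⟨ cong (_+ Σ< M (λ t → g (suc t) * ⟦ u ≡ᵇ t ⟧)) (*-zeroʳ (g 0)) ⟩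
  Σ< M (λ t → g (suc t) * ⟦ u ≡ᵇ t ⟧)           ≡⟨ Σ<-δ M (λ i → g (suc i)) u u<M ⟩
  g (suc u)                                    ∎
  where open ≡-Reasoning

triangular : ∀ m → 2 * Σ< m (λ t → t) + m ≡ m * m
triangular zero    = refl
triangular (suc m) = begin
  2 * Σ< (suc m) (λ t → t) + suc m       ≡⟨ cong (λ z → 2 * z + suc m) (Σ<-snoc m (λ t → t)) ⟩
  2 * (Σ< m (λ t → t) + m) + suc m       ≡⟨ regroup (Σ< m (λ t → t)) m ⟩
  (2 * Σ< m (λ t → t) + m) + (2 * m + 1) ≡⟨ cong (_+ (2 * m + 1)) (triangular m) ⟩
  m * m + (2 * m + 1)                    ≡⟨ square-suc m ⟩
  suc m * suc m                          ∎
  where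
  open ≡-Reasoning
  regroup : ∀ S m → 2 * (S + m) + suc m ≡ (2 * S + m) + (2 * m + 1)
  regroup = solve-∀
  square-suc : ∀ m → m * m + (2 * m + 1) ≡ suc m * suc m
  square-suc = solve-∀

any<-witness : ∀ m P → any< m P ≡ true → ∃ λ i → i < m × P i ≡ true
any<-witness (suc m) P e with P 0 in e0
... | true  = 0 , s≤s z≤n , e0
... | false with any<-witness m (λ i → P (suc i)) e
... | i , i<m , Pi = suc i , s≤s i<m , Pi

any<-intro : ∀ m P i → i < m → P i ≡ true → any< m P ≡ true
any<-intro (suc m) P zero    _         Pi rewrite Pi = refl
any<-intro (suc m) P (suc i) (s≤s i<m) Pi
  rewrite any<-intro m (λ j → P (suc j)) i i<m Pi = ∨-zeroʳ (P 0)

any<-cong : ∀ m {P Q} → (∀ i → i < m → P i ≡ Q i) → any< m P ≡ any< m Q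
any<-cong zero    _ = refl
any<-cong (suc m) h = cong₂ _∨_ (h 0 (s≤s z≤n)) (any<-cong m (λ i i<m → h (suc i) (s≤s i<m)))

count≡0 : ∀ m P → (∀ i → i < m → P i ≡ false) → count m P ≡ 0
count≡0 m P h = Σ<-zero m (λ i i<m → cong ⟦_⟧ (h i i<m))

count>0⇒witness : ∀ m P → 0 < count m P → ∃ λ i → i < m × P i ≡ true
count>0⇒witness (suc m) P pos with P 0 in e0
... | true  = 0 , s≤s z≤n , e0
... | false with count>0⇒witness m (λ i → P (suc i)) pos
... | i , i<m , Pi = suc i , s≤s i<m , Pi

count≡0⇒false : ∀ m P → count m P ≡ 0 → ∀ i → i < m → P i ≡ false
count≡0⇒false (suc m) P c0 i i<m with P 0 in e0
count≡0⇒false (suc m) P () i i<m | true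
count≡0⇒false (suc m) P c0 zero    _         | false = e0
count≡0⇒false (suc m) P c0 (suc i) (s≤s i<m) | false = count≡0⇒false m (λ j → P (suc j)) c0 i i<m

count-unique : ∀ m P → (∀ i j → i < m → j < m → P i ≡ true → P j ≡ true → i ≡ j) →
  count m P ≡ ⟦ any< m P ⟧
count-unique zero    P _ = refl
count-unique (suc m) P unique with P 0 in e0
... | true  = cong suc (count≡0 m (λ i → P (suc i)) (λ i i<m → ¬-not (only-0 i<m)))
  where
  only-0 : ∀ {i} → i < m → P (suc i) ≢ true
  only-0 i<m Pi with () ← unique 0 _ (s≤s z≤n) (s≤s i<m) e0 Pi
... | false = count-unique m (λ i → P (suc i))
  (λ i j i<m j<m Pi Pj → suc-injective (unique (suc i) (suc j) (s≤s i<m) (s≤s j<m) Pi Pj))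

⟦⟧-split : ∀ a b → ⟦ a ⟧ ≡ ⟦ a ∧ b ⟧ + ⟦ a ∧ not b ⟧
⟦⟧-split true  true  = refl
⟦⟧-split true  false = refl
⟦⟧-split false _     = refl

count-split : ∀ m (P Q : ℕ → Bool) → count m P ≡ count m (λ i → P i ∧ Q i) + count m (λ i → P i ∧ not (Q i))
count-split m P Q = trans (Σ<-cong m {g = λ i → ⟦ P i ∧ Q i ⟧ + ⟦ P i ∧ not (Q i) ⟧} (λ i _ → ⟦⟧-split (P i) (Q i)))
  (Σ<-+ m (λ i → ⟦ P i ∧ Q i ⟧) (λ i → ⟦ P i ∧ not (Q i) ⟧))

⊆∧count≡⇒⊇ : ∀ m (P Q : ℕ → Bool) → (∀ i → i < m → P i ≡ true → Q i ≡ true) → count m P ≡ count m Q →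
  ∀ i → i < m → Q i ≡ true → P i ≡ true
⊆∧count≡⇒⊇ m P Q P⊆Q same i i<m Qi =
  not-injective (subst (λ b → (b ∧ not (P i)) ≡ false) Qi (count≡0⇒false m _ Q∖P-empty i i<m))
  where
  open ≡-Reasoning
  ∧-absorbs-⊆ : ∀ j → j < m → ⟦ Q j ∧ P j ⟧ ≡ ⟦ P j ⟧
  ∧-absorbs-⊆ j j<m with P j in ePj
  ... | true  = cong (λ b → ⟦ b ∧ true ⟧) (P⊆Q j j<m ePj)
  ... | false = cong ⟦_⟧ (∧-zeroʳ (Q j))
  Q∖P-empty : count m (λ j → Q j ∧ not (P j)) ≡ 0
  Q∖P-empty = +-cancelˡ-≡ (count m P) _ _ (begin
    count m P + count m (λ j → Q j ∧ not (P j))                     ≡⟨ cong (_+ count m (λ j → Q j ∧ not (P j))) (sym (Σ<-cong m ∧-absorbs-⊆)) ⟩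
    count m (λ j → Q j ∧ P j) + count m (λ j → Q j ∧ not (P j))    ≡⟨ sym (count-split m Q P) ⟩
    count m Q                                                      ≡⟨ sym same ⟩
    count m P                                                      ≡⟨ sym (+-identityʳ _) ⟩
    count m P + 0                                                  ∎)

Σ<-reindex : ∀ m M (D : ℕ → Bool) (h g : ℕ → ℕ) →
  (∀ i → i < m → D i ≡ true → h i < M) →
  (∀ i j → i < m → j < m → D i ≡ true → D j ≡ true → h i ≡ h j → i ≡ j) →
  Σ< m (λ i → ⟦ D i ⟧ * g (h i)) ≡ Σ< M (λ t → g t * ⟦ image m D h t ⟧)
Σ<-reindex m M D h g h<M h-inj = begin
  Σ< m (λ i → ⟦ D i ⟧ * g (h i))                          ≡⟨ Σ<-cong m as-δ-sum ⟩
  Σ< m (λ i → Σ< M (λ t → g t * ⟦ D i ∧ (h i ≡ᵇ t) ⟧))    ≡⟨ Σ<-swap m M _ ⟩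
  Σ< M (λ t → Σ< m (λ i → g t * ⟦ D i ∧ (h i ≡ᵇ t) ⟧))    ≡⟨ Σ<-cong M (λ t _ → Σ<-*ˡ m (g t) _) ⟩
  Σ< M (λ t → g t * count m (λ i → D i ∧ (h i ≡ᵇ t)))     ≡⟨ Σ<-cong M (λ t _ → cong (g t *_) (count-unique m _ (fibre-unique t))) ⟩
  Σ< M (λ t → g t * ⟦ image m D h t ⟧)                    ∎
  where
  open ≡-Reasoning
  as-δ-sum : ∀ i → i < m → ⟦ D i ⟧ * g (h i) ≡ Σ< M (λ t → g t * ⟦ D i ∧ (h i ≡ᵇ t) ⟧)
  as-δ-sum i i<m with D i in Di
  ... | true  = trans (+-identityʳ (g (h i))) (sym (Σ<-δ M g (h i) (h<M i i<m Di)))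
  ... | false = sym (Σ<-zero M (λ t _ → *-zeroʳ (g t)))
  fibre-unique : ∀ t i j → i < m → j < m →
    (D i ∧ (h i ≡ᵇ t)) ≡ true → (D j ∧ (h j ≡ᵇ t)) ≡ true → i ≡ j
  fibre-unique t i j i<m j<m ei ej with ∧-true {D i} ei | ∧-true {D j} ej
  ... | Di , hi≡t | Dj , hj≡t = h-inj i j i<m j<m Di Dj (trans (≡ᵇ-true hi≡t) (sym (≡ᵇ-true hj≡t)))

FixedPointFreeInvolution : ℕ → (ℕ → Bool) → (ℕ → ℕ) → Set
FixedPointFreeInvolution m P f = ∀ t → t < m → P t ≡ true → f t < m × P (f t) ≡ true × f (f t) ≡ t × f t ≢ t

module _ {m P f} (inv : FixedPointFreeInvolution m P f) where

  below-orbit above-orbit : ℕ → Bool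
  below-orbit t = P t ∧ (t <ᵇ f t)
  above-orbit t = P t ∧ not (t <ᵇ f t)

  below⇒above : ∀ i → i < m → below-orbit i ≡ true → above-orbit (f i) ≡ true
  below⇒above i i<m below-i with ∧-true {P i} below-i
  ... | Pi , i<fi with inv i i<m Pi
  ... | _ , Pfi , ffi≡i , _ rewrite Pfi | ffi≡i = cong not (≮⇒<ᵇ-false {f i} (<-asym (<ᵇ-true {i} i<fi)))

  above⇒below : ∀ t → t < m → above-orbit t ≡ true → below-orbit (f t) ≡ true
  above⇒below t t<m above-t with ∧-true {P t} above-t
  ... | Pt , ¬t<ft with inv t t<m Pt
  ... | _ , Pft , fft≡t , ft≢t rewrite Pft | fft≡t = <⇒<ᵇ-true ft<t
    where
    ft<t : f t < t
    ft<t = ≤∧≢⇒< (≮⇒≥ (λ t<ft → not-¬ (cong not (<⇒<ᵇ-true t<ft)) ¬t<ft)) ft≢t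

  image-below-orbit : ∀ t → t < m → image m below-orbit f t ≡ above-orbit t
  image-below-orbit t t<m = ⇔→≡ (mk⇔ to from)
    where
    to : image m below-orbit f t ≡ true → above-orbit t ≡ true
    to e with any<-witness m (λ i → below-orbit i ∧ (f i ≡ᵇ t)) e
    ... | i , i<m , below∧fi≡t with ∧-true {below-orbit i} below∧fi≡t
    ... | below-i , fi≡t = subst (λ u → above-orbit u ≡ true) (≡ᵇ-true {f i} fi≡t) (below⇒above i i<m below-i)
    from : above-orbit t ≡ true → image m below-orbit f t ≡ true
    from above-t with inv t t<m (proj₁ (∧-true {P t} above-t))
    ... | ft<m , _ , fft≡t , _ = any<-intro m (λ i → below-orbit i ∧ (f i ≡ᵇ t)) (f t) ft<m
      (subst (λ u → (below-orbit (f t) ∧ (u ≡ᵇ t)) ≡ true) (sym fft≡t)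
        (subst (λ b → (b ∧ (t ≡ᵇ t)) ≡ true) (sym (above⇒below t t<m above-t)) (≡⇒≡ᵇ-true {t} refl)))

  count-below≡count-above : count m below-orbit ≡ count m above-orbit
  count-below≡count-above = begin
    count m below-orbit                          ≡⟨ Σ<-cong m (λ i _ → sym (*-identityʳ ⟦ below-orbit i ⟧)) ⟩
    Σ< m (λ i → ⟦ below-orbit i ⟧ * 1)           ≡⟨ Σ<-reindex m m below-orbit f (λ _ → 1) maps-into injective ⟩
    Σ< m (λ t → 1 * ⟦ image m below-orbit f t ⟧) ≡⟨ Σ<-cong m (λ t t<m → trans (*-identityˡ _) (cong ⟦_⟧ (image-below-orbit t t<m))) ⟩
    count m above-orbit                          ∎
    where
    open ≡-Reasoning
    in-P : ∀ {i} → below-orbit i ≡ true → P i ≡ true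
    in-P {i} below-i = proj₁ (∧-true {P i} below-i)
    maps-into : ∀ i → i < m → below-orbit i ≡ true → f i < m
    maps-into i i<m below-i = proj₁ (inv i i<m (in-P below-i))
    injective : ∀ i j → i < m → j < m → below-orbit i ≡ true → below-orbit j ≡ true → f i ≡ f j → i ≡ j
    injective i j i<m j<m below-i below-j fi≡fj = begin
      i         ≡⟨ proj₁ (proj₂ (proj₂ (inv i i<m (in-P below-i)))) ⟨
      f (f i)   ≡⟨ cong f fi≡fj ⟩
      f (f j)   ≡⟨ proj₁ (proj₂ (proj₂ (inv j j<m (in-P below-j)))) ⟩
      j         ∎

  count-involution : count m P ≡ 2 * count m below-orbit
  count-involution = begin
    count m P                                  ≡⟨ count-split m P (λ t → t <ᵇ f t) ⟩
    count m below-orbit + count m above-orbit  ≡⟨ cong (_+_ (count m below-orbit)) count-below≡count-above ⟨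
    count m below-orbit + count m below-orbit  ≡⟨ cong (_+_ (count m below-orbit)) (+-identityʳ _) ⟨
    2 * count m below-orbit                    ∎
    where open ≡-Reasoning

true-false-transition : ∀ (f : ℕ → Bool) a d → f a ≡ true → f (a + d) ≡ false →
  ∃ λ j → a ≤ j × j < a + d × f j ≡ true × f (suc j) ≡ false
true-false-transition f a zero    fa fa+d with () ← trans (sym fa) (subst (λ z → f z ≡ false) (+-identityʳ a) fa+d)
true-false-transition f a (suc d) fa fa+d with f (suc a) in e
... | false = a , ≤-refl , subst (a <_) (sym (+-suc a d)) (s≤s (m≤m+n a d)) , fa , e
... | true with true-false-transition f (suc a) d e (subst (λ z → f z ≡ false) (+-suc a d) fa+d)
... | j , a<j , j<a+d , fj , fsj = j , <⇒≤ a<j , subst (j <_) (sym (+-suc a d)) j<a+d , fj , fsj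

+-%-wrap : ∀ d .{{_ : NonZero d}} a b c → a < d → c < d → 0 < c → (a + c) % d ≡ b →
  b + d * ⟦ not (a <ᵇ b) ⟧ ≡ a + c
+-%-wrap d a b c a<d c<d 0<c [a+c]%d≡b with (a + c) / d | a+c≡ | quotient<2
  where
  a+c≡ : a + c ≡ b + (a + c) / d * d
  a+c≡ = trans (m≡m%n+[m/n]*n (a + c) d) (cong (_+ (a + c) / d * d) [a+c]%d≡b)
  quotient<2 : (a + c) / d < 2
  quotient<2 = m<n*o⇒m/o<n (subst (a + c <_) (cong (_+_ d) (sym (+-identityʳ d))) (+-mono-< a<d c<d))
... | 0 | a+c≡b+0 | _ = begin
  b + d * ⟦ not (a <ᵇ b) ⟧  ≡⟨ cong (λ x → b + d * ⟦ not x ⟧) (<⇒<ᵇ-true a<b) ⟩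
  b + d * 0                 ≡⟨ cong (_+_ b) (*-zeroʳ d) ⟩
  b + 0                     ≡⟨ a+c≡b+0 ⟨
  a + c                     ∎
  where
  open ≡-Reasoning
  a<b : a < b
  a<b = subst (a <_) (trans a+c≡b+0 (+-identityʳ b)) (m<m+n a 0<c)
... | 1 | a+c≡b+d | _ = begin
  b + d * ⟦ not (a <ᵇ b) ⟧  ≡⟨ cong (λ x → b + d * ⟦ not x ⟧) (≮⇒<ᵇ-false b≤a) ⟩
  b + d * 1                 ≡⟨ cong (_+_ b) (*-identityʳ d) ⟩
  b + d                     ≡⟨ cong (_+_ b) (+-identityʳ d) ⟨
  b + (d + 0)               ≡⟨ a+c≡b+d ⟨
  a + c                     ∎
  where
  open ≡-Reasoning
  b≤a : ¬ a < b
  b≤a a<b = <-irrefl (trans a+c≡b+d (cong (_+_ b) (+-identityʳ d))) (+-mono-< a<b c<d)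
... | suc (suc _) | _ | s≤s (s≤s ())

any-applyUpTo : ∀ (P : ℕ → Bool) h m → any P (applyUpTo h m) ≡ any< m (λ i → P (h i))
any-applyUpTo P h zero    = refl
any-applyUpTo P h (suc m) = cong (P (h 0) ∨_) (any-applyUpTo P (λ i → h (suc i)) m)

length-filter-applyUpTo : ∀ {P : ℕ → Set} (P? : Decidable P) h m →
  length (filter P? (applyUpTo h m)) ≡ count m (λ i → does (P? (h i)))
length-filter-applyUpTo P? h zero    = refl
length-filter-applyUpTo P? h (suc m) with does (P? (h 0))
... | true  = cong suc (length-filter-applyUpTo P? (λ i → h (suc i)) m)
... | false = length-filter-applyUpTo P? (λ i → h (suc i)) m

sq : ℕ → ℕ
sq x = x * x

difference-of-squares : ∀ x y → y ≤ x → (x ∸ y) * (x + y) + sq y ≡ sq x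
difference-of-squares x y y≤x = begin
  (x ∸ y) * (x + y) + sq y        ≡⟨ cong (λ z → (x ∸ y) * z + sq y) (+-comm x y) ⟩
  (x ∸ y) * (y + x) + sq y        ≡⟨ cong (λ z → (x ∸ y) * (y + z) + sq y) (m+[n∸m]≡n y≤x) ⟨
  d * (y + (y + d)) + sq y        ≡⟨ expand y d ⟩
  (y + d) * (y + d)               ≡⟨ cong sq (m+[n∸m]≡n y≤x) ⟩
  sq x                            ∎
  where
  open ≡-Reasoning
  d = x ∸ y
  expand : ∀ y d → d * (y + (y + d)) + y * y ≡ (y + d) * (y + d)
  expand = solve-∀

-- Arithmetic modulo p

-- The modulus is written suc q so that NonZero p is found by instance search; q stands for −1.
module ModularArithmetic (q : ℕ) where

  p : ℕ
  p = suc q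

  infix 4 _≡ₚ_
  _≡ₚ_ : ℕ → ℕ → Set
  x ≡ₚ y = x % p ≡ y % p

  %-idem : ∀ x → x % p ≡ₚ x
  %-idem x = m%n%n≡m%n x p

  +-congₚ : ∀ {a a′ b b′} → a ≡ₚ a′ → b ≡ₚ b′ → a + b ≡ₚ a′ + b′
  +-congₚ {a} {a′} {b} {b′} a≡a′ b≡b′ = begin
    (a + b) % p               ≡⟨ %-distribˡ-+ a b p ⟩
    (a % p + b % p) % p       ≡⟨ cong₂ (λ u v → (u + v) % p) a≡a′ b≡b′ ⟩
    (a′ % p + b′ % p) % p     ≡⟨ %-distribˡ-+ a′ b′ p ⟨
    (a′ + b′) % p             ∎
    where open ≡-Reasoning

  *-congₚ : ∀ {a a′ b b′} → a ≡ₚ a′ → b ≡ₚ b′ → a * b ≡ₚ a′ * b′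
  *-congₚ {a} {a′} {b} {b′} a≡a′ b≡b′ = begin
    (a * b) % p               ≡⟨ %-distribˡ-* a b p ⟩
    (a % p * (b % p)) % p     ≡⟨ cong₂ (λ u v → (u * v) % p) a≡a′ b≡b′ ⟩
    (a′ % p * (b′ % p)) % p   ≡⟨ %-distribˡ-* a′ b′ p ⟨
    (a′ * b′) % p             ∎
    where open ≡-Reasoning

  *-congˡₚ : ∀ a {b b′} → b ≡ₚ b′ → a * b ≡ₚ a * b′
  *-congˡₚ a = *-congₚ {a} {a} refl

  +-kp≡ₚ : ∀ x k → x + k * p ≡ₚ x
  +-kp≡ₚ x k = [m+kn]%n≡m%n x k p

  <p⇒%≡ : ∀ {x} → x < p → x % p ≡ x
  <p⇒%≡ = m<n⇒m%n≡m

  ≡ₚ⇒≡ : ∀ {x y} → x < p → y < p → x ≡ₚ y → x ≡ y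
  ≡ₚ⇒≡ x<p y<p x≡y = trans (sym (<p⇒%≡ x<p)) (trans x≡y (<p⇒%≡ y<p))

  %≡⇒≡ₚ : ∀ x {t} → x % p ≡ t → x ≡ₚ t
  %≡⇒≡ₚ x x%p≡t = trans (sym (%-idem x)) (cong (_% p) x%p≡t)

  +-cancelʳₚ : ∀ x y d → x + d ≡ₚ y + d → x ≡ₚ y
  +-cancelʳₚ x y d x+d≡y+d = begin
    x % p                      ≡⟨ +-kp≡ₚ x (suc (d / p)) ⟨
    (x + suc (d / p) * p) % p  ≡⟨ cong (λ z → (x + z) % p) d+e≡ ⟩
    (x + (d + e)) % p          ≡⟨ cong (_% p) (+-assoc x d e) ⟨
    ((x + d) + e) % p          ≡⟨ +-congₚ {x + d} {y + d} {e} x+d≡y+d refl ⟩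
    ((y + d) + e) % p          ≡⟨ cong (_% p) (+-assoc y d e) ⟩
    (y + (d + e)) % p          ≡⟨ cong (λ z → (y + z) % p) d+e≡ ⟨
    (y + suc (d / p) * p) % p  ≡⟨ +-kp≡ₚ y (suc (d / p)) ⟩
    y % p                      ∎
    where
    open ≡-Reasoning
    -- e is chosen so that d + e is a multiple of p.
    e = p ∸ d % p
    d+e≡ : suc (d / p) * p ≡ d + e
    d+e≡ = begin
      suc (d / p) * p          ≡⟨ +-comm p (d / p * p) ⟩
      d / p * p + p            ≡⟨ cong (_+_ (d / p * p)) (m+[n∸m]≡n (m%n≤n d p)) ⟨
      d / p * p + (d % p + e)  ≡⟨ +-assoc (d / p * p) (d % p) e ⟨
      (d / p * p + d % p) + e  ≡⟨ cong (_+ e) (+-comm (d / p * p) (d % p)) ⟩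
      (d % p + d / p * p) + e  ≡⟨ cong (_+ e) (m≡m%n+[m/n]*n d p) ⟨
      d + e                    ∎

  0<x<p⇒≢ₚ0 : ∀ {x} → 0 < x → x < p → x % p ≢ 0
  0<x<p⇒≢ₚ0 {suc x} _ x<p x≡0 = 0≢1+n (trans (sym x≡0) (<p⇒%≡ x<p))

  [-d]%ℕ+d≡ₚ0 : ∀ d → 0 < d → ((ℤ.- (+ d)) %ℕ p + d) % p ≡ 0
  [-d]%ℕ+d≡ₚ0 (suc j) _ with suc j % p in e
  ... | zero  = e
  ... | suc r = begin
    (p ∸ suc r + suc j) % p   ≡⟨ +-congₚ {p ∸ suc r} {p ∸ suc r} {suc j} {suc r} refl (trans e (sym (<p⇒%≡ 1+r<p))) ⟩
    (p ∸ suc r + suc r) % p   ≡⟨ cong (_% p) (m∸n+n≡m (<⇒≤ 1+r<p)) ⟩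
    p % p                     ≡⟨ n%n≡0 p ⟩
    0                         ∎
    where
    open ≡-Reasoning
    1+r<p : suc r < p
    1+r<p = subst (_< p) e (m%n<n (suc j) p)

  [m+b]%ℕ≡[m+b%ℕ]% : ∀ m b → (+ m ℤ.+ b) %ℕ p ≡ (m + b %ℕ p) % p
  [m+b]%ℕ≡[m+b%ℕ]% m (+ j) = +-congₚ {m} {m} {j} {j % p} refl (sym (%-idem j))
  [m+b]%ℕ≡[m+b%ℕ]% m -[1+ j ] with m ≤? j
  ... | no  m≰j = begin
    (m ⊖ suc j) %ℕ p                 ≡⟨ cong (_%ℕ p) (⊖-≥ (≰⇒> m≰j)) ⟩
    (m ∸ suc j) % p                  ≡⟨ cong (_% p) (+-identityʳ (m ∸ suc j)) ⟨
    (m ∸ suc j + 0) % p              ≡⟨ +-congₚ {m ∸ suc j} {m ∸ suc j} {0} refl (sym ([-d]%ℕ+d≡ₚ0 (suc j) (s≤s z≤n))) ⟩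
    (m ∸ suc j + (t + suc j)) % p    ≡⟨ cong (_% p) regroup ⟩
    (m + t) % p                      ∎
    where
    open ≡-Reasoning
    t = -[1+ j ] %ℕ p
    regroup : m ∸ suc j + (t + suc j) ≡ m + t
    regroup = begin
      m ∸ suc j + (t + suc j)  ≡⟨ cong (_+_ (m ∸ suc j)) (+-comm t (suc j)) ⟩
      m ∸ suc j + (suc j + t)  ≡⟨ +-assoc (m ∸ suc j) (suc j) t ⟨
      m ∸ suc j + suc j + t    ≡⟨ cong (_+ t) (m∸n+n≡m (≰⇒> m≰j)) ⟩
      m + t                    ∎
  ... | yes m≤j = begin
    (m ⊖ suc j) %ℕ p     ≡⟨ cong (_%ℕ p) (⊖-< (s≤s m≤j)) ⟩
    t′                   ≡⟨ <p⇒%≡ (n%ℕd<d (ℤ.- (+ d)) p) ⟨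
    t′ % p               ≡⟨ +-cancelʳₚ t′ (m + t) d (trans ([-d]%ℕ+d≡ₚ0 d (m<n⇒0<n∸m (s≤s m≤j))) (sym m+t+d≡ₚ0)) ⟩
    (m + t) % p          ∎
    where
    open ≡-Reasoning
    t = -[1+ j ] %ℕ p
    d = suc j ∸ m
    t′ = (ℤ.- (+ d)) %ℕ p
    m+t+d≡ₚ0 : (m + t + d) % p ≡ 0
    m+t+d≡ₚ0 = begin
      (m + t + d) % p      ≡⟨ cong (λ z → (z + d) % p) (+-comm m t) ⟩
      (t + m + d) % p      ≡⟨ cong (_% p) (+-assoc t m d) ⟩
      (t + (m + d)) % p    ≡⟨ cong (λ z → (t + z) % p) (m+[n∸m]≡n (<⇒≤ (s≤s m≤j))) ⟩
      (t + suc j) % p      ≡⟨ [-d]%ℕ+d≡ₚ0 (suc j) (s≤s z≤n) ⟩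
      0                    ∎

module PrimeModulus (q : ℕ) (p-prime : Prime (suc q)) where

  open ModularArithmetic q public

  1<p : 1 < p
  1<p = nonTrivial⇒n>1 p {{prime⇒nonTrivial p-prime}}

  no-zero-divisors : ∀ x y → (x * y) % p ≡ 0 → x % p ≡ 0 ⊎ y % p ≡ 0
  no-zero-divisors x y xy≡0 with euclidsLemma x y p-prime (m%n≡0⇒n∣m (x * y) p xy≡0)
  ... | inj₁ p∣x = inj₁ (n∣m⇒m%n≡0 x p p∣x)
  ... | inj₂ p∣y = inj₂ (n∣m⇒m%n≡0 y p p∣y)

  *-nonzeroₚ : ∀ x y → x % p ≢ 0 → y % p ≢ 0 → (x * y) % p ≢ 0
  *-nonzeroₚ x y x≢0 y≢0 xy≡0 with no-zero-divisors x y xy≡0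
  ... | inj₁ x≡0 = x≢0 x≡0
  ... | inj₂ y≡0 = y≢0 y≡0

  inverse : ∀ x → x % p ≢ 0 → ∃ λ y → x * y ≡ₚ 1
  inverse x x≢0 with coprime-Bézout (prime⇒coprime p-prime {{≢-nonZero x≢0}} (m%n<n x p))
  ... | Bézout.-+ a b eq = b , (begin
    (x * b) % p          ≡⟨ *-congₚ {x % p} {x} {b} {b} (%-idem x) refl ⟨
    (x % p * b) % p      ≡⟨ cong (_% p) (*-comm (x % p) b) ⟩
    (b * (x % p)) % p    ≡⟨ cong (_% p) eq ⟨
    (1 + a * p) % p      ≡⟨ +-kp≡ₚ 1 a ⟩
    1 % p                ∎)
    where open ≡-Reasoning
  -- Here b · {x} ≡ −1, so b · q ≡ b · (−1) inverts x.
  ... | Bézout.+- a b eq = b * q , (begin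
    (x * (b * q)) % p                ≡⟨ *-congₚ {r} {x} {b * q} {b * q} (%-idem x) refl ⟨
    (r * (b * q)) % p                ≡⟨ +-kp≡ₚ (r * (b * q)) a ⟨
    (r * (b * q) + a * p) % p        ≡⟨ cong (λ z → (r * (b * q) + z) % p) eq ⟨
    (r * (b * q) + (1 + b * r)) % p  ≡⟨ cong (_% p) (regroup r b q) ⟩
    (1 + (r * b) * p) % p            ≡⟨ +-kp≡ₚ 1 (r * b) ⟩
    1 % p                            ∎)
    where
    open ≡-Reasoning
    r = x % p
    regroup : ∀ r b q → r * (b * q) + (1 + b * r) ≡ 1 + (r * b) * suc q
    regroup = solve-∀

  *-cancelˡₚ : ∀ x u v → x % p ≢ 0 → x * u ≡ₚ x * v → u ≡ₚ v
  *-cancelˡₚ x u v x≢0 xu≡xv with inverse x x≢0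
  ... | y , xy≡1 = begin
    u % p              ≡⟨ cong (_% p) (*-identityˡ u) ⟨
    (1 * u) % p        ≡⟨ *-congₚ {1} {x * y} {u} {u} (sym xy≡1) refl ⟩
    ((x * y) * u) % p  ≡⟨ cong (_% p) (reassoc x y u) ⟩
    (y * (x * u)) % p  ≡⟨ *-congˡₚ y xu≡xv ⟩
    (y * (x * v)) % p  ≡⟨ cong (_% p) (reassoc x y v) ⟨
    ((x * y) * v) % p  ≡⟨ *-congₚ {x * y} {1} {v} {v} xy≡1 refl ⟩
    (1 * v) % p        ≡⟨ cong (_% p) (*-identityˡ v) ⟩
    v % p              ∎
    where
    open ≡-Reasoning
    reassoc : ∀ x y u → (x * y) * u ≡ y * (x * u)
    reassoc = solve-∀

  inverse-nonzero : ∀ x y → x * y ≡ₚ 1 → y % p ≢ 0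
  inverse-nonzero x y xy≡1 y≡0 = 0≢1+n (begin
    0                ≡⟨ cong (_% p) (*-zeroʳ x) ⟨
    (x * 0) % p      ≡⟨ *-congˡₚ x {0} {y} (sym y≡0) ⟩
    (x * y) % p      ≡⟨ xy≡1 ⟩
    1 % p            ≡⟨ <p⇒%≡ 1<p ⟩
    1                ∎)
    where open ≡-Reasoning

  -- The value at multiples of p is junk.
  inv : ℕ → ℕ
  inv t with t % p ≟ 0
  ... | yes _   = 0
  ... | no  t≢0 = proj₁ (inverse t t≢0) % p

  inv-inverse : ∀ t → t % p ≢ 0 → t * inv t ≡ₚ 1
  inv-inverse t t≢0 with t % p ≟ 0
  ... | yes t≡0 = ⊥-elim (t≢0 t≡0)
  ... | no  _   = let y , ty≡1 = inverse t t≢0 in trans (*-congˡₚ t (%-idem y)) ty≡1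

  inv<p : ∀ t → inv t < p
  inv<p t with t % p ≟ 0
  ... | yes _   = s≤s z≤n
  ... | no  t≢0 = m%n<n (proj₁ (inverse t t≢0)) p

  sq≡ₚ1⇒±1 : ∀ t → 0 < t → t < p → sq t ≡ₚ 1 → t ≡ 1 ⊎ t ≡ q
  sq≡ₚ1⇒±1 (suc u) _ t<p t²≡1 with no-zero-divisors u (suc (suc u)) (+-cancelʳₚ (u * suc (suc u)) 0 1 (trans (cong (_% p) (expand u)) t²≡1))
    where
    expand : ∀ u → u * suc (suc u) + 1 ≡ suc u * suc u
    expand = solve-∀
  ... | inj₁ u≡0 = inj₁ (cong suc (trans (sym (<p⇒%≡ (<-trans (n<1+n u) t<p))) u≡0))
  ... | inj₂ u+2≡0 with m≤n⇒m<n∨m≡n t<p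
  ...   | inj₁ u+2<p = ⊥-elim (0<x<p⇒≢ₚ0 (s≤s z≤n) u+2<p u+2≡0)
  ...   | inj₂ u+2≡p = inj₂ (suc-injective u+2≡p)

  inv-involutive : ∀ t → t < p → t % p ≢ 0 → inv (inv t) ≡ t
  inv-involutive t t<p t≢0 = ≡ₚ⇒≡ (inv<p (inv t)) t<p (*-cancelˡₚ (inv t) (inv (inv t)) t t⁻¹≢0 (begin
    (inv t * inv (inv t)) % p  ≡⟨ inv-inverse (inv t) t⁻¹≢0 ⟩
    1 % p                      ≡⟨ inv-inverse t t≢0 ⟨
    (t * inv t) % p            ≡⟨ cong (_% p) (*-comm t (inv t)) ⟩
    (inv t * t) % p            ∎))
    where
    open ≡-Reasoning
    t⁻¹≢0 : inv t % p ≢ 0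
    t⁻¹≢0 = inverse-nonzero t (inv t) (inv-inverse t t≢0)

  inv-fixed⇒±1 : ∀ t → t < p → t % p ≢ 0 → inv t ≡ t → t ≡ 1 ⊎ t ≡ q
  inv-fixed⇒±1 t t<p t≢0 t⁻¹≡t =
    sq≡ₚ1⇒±1 t (n≢0⇒n>0 (λ t≡0 → t≢0 (cong (_% p) t≡0))) t<p (subst (λ u → t * u ≡ₚ 1) t⁻¹≡t (inv-inverse t t≢0))

  inv≡1⇒≡1 : ∀ t → t < p → t % p ≢ 0 → inv t ≡ 1 → t ≡ 1
  inv≡1⇒≡1 t t<p t≢0 t⁻¹≡1 = ≡ₚ⇒≡ t<p 1<p (begin
    t % p              ≡⟨ cong (_% p) (*-identityʳ t) ⟨
    (t * 1) % p        ≡⟨ *-congˡₚ t (cong (_% p) t⁻¹≡1) ⟨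
    (t * inv t) % p    ≡⟨ inv-inverse t t≢0 ⟩
    1 % p              ∎)
    where open ≡-Reasoning

module OddPrime (q : ℕ) (p-prime : Prime (suc q)) (p>3 : suc q > 3) where

  open PrimeModulus q p-prime

  p%2≡1 : p % 2 ≡ 1
  p%2≡1 with p % 2 in e
  ... | zero with prime⇒irreducible p-prime (m%n≡0⇒n∣m p 2 e)
  ...   | inj₁ ()
  ...   | inj₂ 2≡p = ⊥-elim (<-irrefl 2≡p (<-trans (s≤s (s≤s (s≤s z≤n))) p>3))
  p%2≡1 | suc zero    = refl
  p%2≡1 | suc (suc k) = ⊥-elim (≤⇒≯ (s≤s (s≤s z≤n)) (subst (_< 2) e (m%n<n p 2)))

  n : ℕ
  n = (p ∸ 1) / 2

  q≡[p/2]*2 : q ≡ p / 2 * 2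
  q≡[p/2]*2 = suc-injective (trans (m≡m%n+[m/n]*n p 2) (cong (_+ p / 2 * 2) p%2≡1))

  p≡2n+1 : p ≡ suc (n + n)
  p≡2n+1 = cong suc (begin
    q                    ≡⟨ q≡[p/2]*2 ⟩
    p / 2 * 2            ≡⟨ cong (_* 2) (m*n/n≡m (p / 2) 2) ⟨
    (p / 2 * 2) / 2 * 2  ≡⟨ cong (λ m → m / 2 * 2) q≡[p/2]*2 ⟨
    n * 2                ≡⟨ double n ⟩
    n + n                ∎)
    where
    open ≡-Reasoning
    double : ∀ n → n * 2 ≡ n + n
    double = solve-∀

  n<p : n < p
  n<p = subst (n <_) (sym p≡2n+1) (s≤s (m≤m+n n n))

  2≤n : 2 ≤ n
  2≤n with n | p≡2n+1
  ... | 0           | p≡1 = ⊥-elim (<-irrefl (sym p≡1) (<-trans (s≤s (s≤s z≤n)) p>3))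
  ... | 1           | p≡3 = ⊥-elim (<-irrefl (sym p≡3) p>3)
  ... | suc (suc _) | _   = s≤s (s≤s z≤n)

  1≤q : 1 ≤ q
  1≤q = <-trans (s≤s z≤n) (≤-pred p>3)

  4<p : 4 < p
  4<p = subst (4 <_) (sym p≡2n+1) (s≤s (+-mono-≤ 2≤n 2≤n))

  -- The squares of 1, …, n, indexed from 0.
  s : ℕ → ℕ
  s i = sq (suc i)

  i<n⇒1+i<p : ∀ {i} → i < n → suc i < p
  i<n⇒1+i<p i<n = ≤-<-trans i<n n<p

  s≢ₚ0 : ∀ {i} → i < n → s i % p ≢ 0
  s≢ₚ0 i<n = *-nonzeroₚ (suc _) (suc _) 1+i≢0 1+i≢0
    where 1+i≢0 = 0<x<p⇒≢ₚ0 (s≤s z≤n) (i<n⇒1+i<p i<n)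

  sq-neg : ∀ w → w ≤ p → sq (p ∸ w) ≡ₚ sq w
  sq-neg w w≤p = begin
    sq u % p                          ≡⟨ +-kp≡ₚ (sq u) (2 * w) ⟨
    (sq u + 2 * w * p) % p            ≡⟨ cong (λ z → (sq u + 2 * w * z) % p) u+w≡p ⟨
    (sq u + 2 * w * (u + w)) % p      ≡⟨ cong (_% p) (expand u w) ⟩
    (sq w + (u + w) * (u + w)) % p    ≡⟨ cong (λ z → (sq w + z * z) % p) u+w≡p ⟩
    (sq w + p * p) % p                ≡⟨ +-kp≡ₚ (sq w) p ⟩
    sq w % p                          ∎
    where
    open ≡-Reasoning
    u = p ∸ w
    u+w≡p : u + w ≡ p
    u+w≡p = m∸n+n≡m w≤p
    expand : ∀ u w → u * u + 2 * w * (u + w) ≡ w * w + (u + w) * (u + w)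
    expand = solve-∀

  sq-in-half : ∀ w → 0 < w → w < p → ∃ λ i → i < n × s i ≡ₚ sq w
  sq-in-half (suc w) _ w<p with suc w ≤? n
  ... | yes 1+w≤n = w , 1+w≤n , refl
  ... | no  1+w≰n = i , i<n , trans (cong (λ z → sq z % p) 1+i≡p-w) (sq-neg (suc w) (<⇒≤ w<p))
    where
    i = p ∸ suc w ∸ 1
    1+i≡p-w : suc i ≡ p ∸ suc w
    1+i≡p-w = trans (sym (+-∸-assoc 1 (m<n⇒0<n∸m w<p))) (m+n∸m≡n 1 (p ∸ suc w))
    i<n : i < n
    i<n = subst (_≤ n) (sym 1+i≡p-w) (+-cancelˡ-≤ (suc w) _ _ (begin
      suc w + (p ∸ suc w)  ≡⟨ m+[n∸m]≡n (<⇒≤ w<p) ⟩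
      p                    ≡⟨ p≡2n+1 ⟩
      suc n + n            ≤⟨ +-monoˡ-≤ n (≰⇒> 1+w≰n) ⟩
      suc w + n            ∎))
      where open ≤-Reasoning

  sq-injective-on-half : ∀ x y → 0 < y → y ≤ x → x ≤ n → sq x ≡ₚ sq y → x ≡ y
  sq-injective-on-half x y 0<y y≤x x≤n x²≡y² with no-zero-divisors (x ∸ y) (x + y)
    (+-cancelʳₚ ((x ∸ y) * (x + y)) 0 (sq y) (trans (cong (_% p) (difference-of-squares x y y≤x)) x²≡y²))
  ... | inj₁ x-y≡ₚ0 = ≤-antisym (m∸n≡0⇒m≤n (trans (sym (<p⇒%≡ x-y<p)) x-y≡ₚ0)) y≤x
    where
    x-y<p : x ∸ y < p
    x-y<p = ≤-<-trans (m∸n≤m x y) (≤-<-trans x≤n n<p)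
  ... | inj₂ x+y≡ₚ0 = ⊥-elim (0<x<p⇒≢ₚ0 (<-≤-trans 0<y (m≤n+m y x)) x+y<p x+y≡ₚ0)
    where
    x+y<p : x + y < p
    x+y<p = subst (x + y <_) (sym p≡2n+1) (s≤s (+-mono-≤ x≤n (≤-trans y≤x x≤n)))

  s-injective : ∀ {i j} → i < n → j < n → s i ≡ₚ s j → i ≡ j
  s-injective {i} {j} i<n j<n sᵢ≡sⱼ with ≤-total (suc i) (suc j)
  ... | inj₁ i≤j = sym (suc-injective (sq-injective-on-half (suc j) (suc i) (s≤s z≤n) i≤j j<n (sym sᵢ≡sⱼ)))
  ... | inj₂ j≤i = suc-injective (sq-injective-on-half (suc i) (suc j) (s≤s z≤n) j≤i i<n sᵢ≡sⱼ)

  -- Quadratic residues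

  QR : ℕ → Bool
  QR t = any< n (λ i → s i % p ≡ᵇ t)

  NR : ℕ → Bool
  NR t = not (t ≡ᵇ 0) ∧ not (QR t)

  scaledQR : ℕ → ℕ → Bool
  scaledQR c t = any< n (λ i → (c * s i) % p ≡ᵇ t)

  QR-witness : ∀ {t} → QR t ≡ true → ∃ λ i → i < n × s i % p ≡ t
  QR-witness e with any<-witness n _ e
  ... | i , i<n , sᵢ≡t = i , i<n , ≡ᵇ-true sᵢ≡t

  scaledQR-witness : ∀ c {t} → scaledQR c t ≡ true → ∃ λ i → i < n × (c * s i) % p ≡ t
  scaledQR-witness c e with any<-witness n _ e
  ... | i , i<n , csᵢ≡t = i , i<n , ≡ᵇ-true csᵢ≡t

  QR-intro : ∀ {i t} → i < n → s i % p ≡ t → QR t ≡ true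
  QR-intro {i} i<n sᵢ≡t = any<-intro n _ i i<n (≡⇒≡ᵇ-true sᵢ≡t)

  QR-sq : ∀ x → x % p ≢ 0 → QR (sq x % p) ≡ true
  QR-sq x x≢0 with sq-in-half (x % p) (n≢0⇒n>0 x≢0) (m%n<n x p)
  ... | i , i<n , sᵢ≡x² = QR-intro i<n (trans sᵢ≡x² (*-congₚ {x % p} {x} (%-idem x) (%-idem x)))

  QR⇒sq : ∀ {t} → QR t ≡ true → ∃ λ x → x % p ≢ 0 × sq x % p ≡ t
  QR⇒sq e with QR-witness e
  ... | i , i<n , sᵢ≡t = suc i , 0<x<p⇒≢ₚ0 (s≤s z≤n) (i<n⇒1+i<p i<n) , sᵢ≡t

  QR⇒≢ₚ0 : ∀ {t} → QR t ≡ true → t % p ≢ 0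
  QR⇒≢ₚ0 e t≡0 with QR-witness e
  ... | i , i<n , sᵢ≡t = s≢ₚ0 i<n (trans (%≡⇒≡ₚ (s i) sᵢ≡t) t≡0)

  QR-0 : QR 0 ≡ false
  QR-0 = ¬-not λ e → let i , i<n , sᵢ≡0 = QR-witness e in s≢ₚ0 i<n sᵢ≡0

  QR-1 : QR 1 ≡ true
  QR-1 = QR-intro {0} (<-≤-trans (s≤s z≤n) 2≤n) (<p⇒%≡ 1<p)

  QR-4 : QR 4 ≡ true
  QR-4 = QR-intro {1} 2≤n (<p⇒%≡ 4<p)

  QR-*sq : ∀ {c} x → QR c ≡ true → x % p ≢ 0 → QR ((c * sq x) % p) ≡ true
  QR-*sq {c} x QRc x≢0 with QR⇒sq QRc
  ... | y , y≢0 , y²≡c = subst (λ t → QR t ≡ true) y²x²≡cx² (QR-sq (y * x) (*-nonzeroₚ y x y≢0 x≢0))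
    where
    open ≡-Reasoning
    y²x²≡cx² : sq (y * x) % p ≡ (c * sq x) % p
    y²x²≡cx² = begin
      sq (y * x) % p       ≡⟨ cong (_% p) (sq-* y x) ⟩
      (sq y * sq x) % p    ≡⟨ *-congₚ {sq y} {c} {sq x} (%≡⇒≡ₚ (sq y) y²≡c) refl ⟩
      (c * sq x) % p       ∎
      where
      sq-* : ∀ y x → (y * x) * (y * x) ≡ (y * y) * (x * x)
      sq-* = solve-∀

  QR-* : ∀ {a b} → QR a ≡ true → QR b ≡ true → QR ((a * b) % p) ≡ true
  QR-* {a} {b} QRa QRb with QR⇒sq QRb
  ... | x , x≢0 , x²≡b = subst (λ t → QR t ≡ true) (*-congˡₚ a (%≡⇒≡ₚ (sq x) x²≡b)) (QR-*sq x QRa x≢0)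

  QR-quotient : ∀ c x y → x % p ≢ 0 → y % p ≢ 0 → c * sq x ≡ₚ sq y → QR (c % p) ≡ true
  QR-quotient c x y x≢0 y≢0 cx²≡y² with inverse x x≢0
  ... | x′ , xx′≡1 = subst (λ t → QR t ≡ true) [yx′]²≡c
                       (QR-sq (y * x′) (*-nonzeroₚ y x′ y≢0 (inverse-nonzero x x′ xx′≡1)))
    where
    open ≡-Reasoning
    [yx′]²≡c : sq (y * x′) % p ≡ c % p
    [yx′]²≡c = begin
      sq (y * x′) % p                 ≡⟨ cong (_% p) (regroup₁ y x′) ⟩
      (sq y * sq x′) % p              ≡⟨ *-congₚ {sq y} {c * sq x} {sq x′} (sym cx²≡y²) refl ⟩
      ((c * sq x) * sq x′) % p        ≡⟨ cong (_% p) (regroup₂ c x x′) ⟩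
      (c * ((x * x′) * (x * x′))) % p ≡⟨ *-congˡₚ c (*-congₚ {x * x′} {1} {x * x′} {1} xx′≡1 xx′≡1) ⟩
      (c * 1) % p                     ≡⟨ cong (_% p) (*-identityʳ c) ⟩
      c % p                           ∎
      where
      regroup₁ : ∀ y x′ → (y * x′) * (y * x′) ≡ (y * y) * (x′ * x′)
      regroup₁ = solve-∀
      regroup₂ : ∀ c x x′ → (c * (x * x)) * (x′ * x′) ≡ c * ((x * x′) * (x * x′))
      regroup₂ = solve-∀

  QR-inv : ∀ t → QR t ≡ true → QR (inv t) ≡ true
  QR-inv t QRt with QR⇒sq QRt
  ... | x , x≢0 , x²≡t = subst (λ u → QR u ≡ true) (<p⇒%≡ (inv<p t)) (QR-quotient (inv t) x 1 x≢0 1≢0 t⁻¹x²≡1)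
    where
    open ≡-Reasoning
    1≢0 : 1 % p ≢ 0
    1≢0 = 0<x<p⇒≢ₚ0 (s≤s z≤n) 1<p
    t⁻¹x²≡1 : inv t * sq x ≡ₚ sq 1
    t⁻¹x²≡1 = begin
      (inv t * sq x) % p     ≡⟨ *-congˡₚ (inv t) (%≡⇒≡ₚ (sq x) x²≡t) ⟩
      (inv t * t) % p        ≡⟨ cong (_% p) (*-comm (inv t) t) ⟩
      (t * inv t) % p        ≡⟨ inv-inverse t (QR⇒≢ₚ0 QRt) ⟩
      1 % p                  ∎

  -- Sums over the residue classes

  Σ-scaled : ∀ c → c % p ≢ 0 → ∀ g → Σ< n (λ i → g ((c * s i) % p)) ≡ Σ< p (λ t → g t * ⟦ scaledQR c t ⟧)
  Σ-scaled c c≢0 g = begin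
    Σ< n (λ i → g ((c * s i) % p))      ≡⟨ Σ<-cong n (λ i _ → *-identityˡ (g ((c * s i) % p))) ⟨
    Σ< n (λ i → 1 * g ((c * s i) % p))  ≡⟨ Σ<-reindex n p (λ _ → true) (λ i → (c * s i) % p) g
                                             (λ i _ _ → m%n<n (c * s i) p)
                                             (λ i j i<n j<n _ _ csᵢ≡csⱼ → s-injective i<n j<n (*-cancelˡₚ c (s i) (s j) c≢0 csᵢ≡csⱼ)) ⟩
    Σ< p (λ t → g t * ⟦ scaledQR c t ⟧)  ∎
    where open ≡-Reasoning

  count-scaledQR : ∀ c → c % p ≢ 0 → count p (scaledQR c) ≡ n
  count-scaledQR c c≢0 = begin
    count p (scaledQR c)                  ≡⟨ Σ<-cong p (λ t _ → *-identityˡ ⟦ scaledQR c t ⟧) ⟨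
    Σ< p (λ t → 1 * ⟦ scaledQR c t ⟧)     ≡⟨ Σ-scaled c c≢0 (λ _ → 1) ⟨
    Σ< n (λ _ → 1)                        ≡⟨ Σ<-const n 1 ⟩
    n * 1                                 ≡⟨ *-identityʳ n ⟩
    n                                     ∎
    where open ≡-Reasoning

  scaledQR-1 : ∀ t → scaledQR 1 t ≡ QR t
  scaledQR-1 t = any<-cong n (λ i _ → cong (λ z → z % p ≡ᵇ t) (*-identityˡ (s i)))

  count-QR : count p QR ≡ n
  count-QR = trans (Σ<-cong p (λ t _ → cong ⟦_⟧ (sym (scaledQR-1 t)))) (count-scaledQR 1 (0<x<p⇒≢ₚ0 (s≤s z≤n) 1<p))

  count-NR : count p NR ≡ n
  count-NR = +-cancelˡ-≡ n _ _ (begin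
    n + count p NR                                                        ≡⟨ cong (_+ count p NR) count-QR ⟨
    count p QR + count p NR                                               ≡⟨ cong (_+ count p NR) (Σ<-cong p QR⊆nonzero) ⟩
    count p (λ t → not (t ≡ᵇ 0) ∧ QR t) + count p NR                      ≡⟨ count-split p (λ t → not (t ≡ᵇ 0)) QR ⟨
    Σ< q (λ _ → 1)                                                        ≡⟨ Σ<-const q 1 ⟩
    q * 1                                                                 ≡⟨ *-identityʳ q ⟩
    q                                                                     ≡⟨ suc-injective p≡2n+1 ⟩
    n + n                                                                 ∎)
    where
    open ≡-Reasoning
    QR⊆nonzero : ∀ t → t < p → ⟦ QR t ⟧ ≡ ⟦ not (t ≡ᵇ 0) ∧ QR t ⟧
    QR⊆nonzero zero    _ = cong ⟦_⟧ QR-0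
    QR⊆nonzero (suc t) _ = refl

  class : Bool → ℕ → Bool
  class true  = QR
  class false = NR

  NR-intro : ∀ {t} → t ≢ 0 → QR t ≡ false → NR t ≡ true
  NR-intro {t} t≢0 QRt rewrite ≢⇒≡ᵇ-false t≢0 | QRt = refl

  scaledQR⊆QR : ∀ {c t} → QR c ≡ true → scaledQR c t ≡ true → QR t ≡ true
  scaledQR⊆QR {c} QRc e with scaledQR-witness c e
  ... | i , i<n , csᵢ≡t = subst (λ u → QR u ≡ true) csᵢ≡t (QR-*sq {c} (suc i) QRc (0<x<p⇒≢ₚ0 (s≤s z≤n) (i<n⇒1+i<p i<n)))

  scaledQR⊆NR : ∀ {c t} → 0 < c → c < p → QR c ≡ false → scaledQR c t ≡ true → NR t ≡ true
  scaledQR⊆NR {c} {t} 0<c c<p QRc e with scaledQR-witness c e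
  ... | i , i<n , csᵢ≡t = NR-intro t≢0 (¬-not ¬QRt)
    where
    t≢0 : t ≢ 0
    t≢0 t≡0 = *-nonzeroₚ c (s i) (0<x<p⇒≢ₚ0 0<c c<p) (s≢ₚ0 i<n) (trans csᵢ≡t t≡0)
    ¬QRt : QR t ≢ true
    ¬QRt QRt with QR⇒sq QRt
    ... | y , y≢0 , y²≡t = not-¬ QRc (subst (λ u → QR u ≡ true) (<p⇒%≡ c<p)
          (QR-quotient c (suc i) y (0<x<p⇒≢ₚ0 (s≤s z≤n) (i<n⇒1+i<p i<n)) y≢0
            (trans (%≡⇒≡ₚ (c * s i) csᵢ≡t) (sym (%≡⇒≡ₚ (sq y) y²≡t)))))

  scaledQR⊆class : ∀ c → 0 < c → c < p → ∀ t → t < p → scaledQR c t ≡ true → class (QR c) t ≡ true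
  scaledQR⊆class c 0<c c<p t _ = by-class (QR c) refl
    where
    by-class : ∀ χ → QR c ≡ χ → scaledQR c t ≡ true → class χ t ≡ true
    by-class true  QRc = scaledQR⊆QR QRc
    by-class false QRc = scaledQR⊆NR 0<c c<p QRc

  count-class : ∀ χ → count p (class χ) ≡ n
  count-class true  = count-QR
  count-class false = count-NR

  scaledQR≡class : ∀ c → 0 < c → c < p → ∀ t → t < p → scaledQR c t ≡ class (QR c) t
  scaledQR≡class c 0<c c<p t t<p = ⇔→≡ (mk⇔ (scaledQR⊆class c 0<c c<p t t<p)
    (⊆∧count≡⇒⊇ p (scaledQR c) (class (QR c)) (scaledQR⊆class c 0<c c<p)
      (trans (count-scaledQR c (0<x<p⇒≢ₚ0 0<c c<p)) (sym (count-class (QR c)))) t t<p))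

  Σclass : Bool → (ℕ → ℕ) → ℕ
  Σclass χ g = Σ< p (λ t → g t * ⟦ class χ t ⟧)

  Σ-scaled-class : ∀ c → 0 < c → c < p → ∀ g → Σ< n (λ i → g ((c * s i) % p)) ≡ Σclass (QR c) g
  Σ-scaled-class c 0<c c<p g = trans (Σ-scaled c (0<x<p⇒≢ₚ0 0<c c<p) g)
    (Σ<-cong p (λ t t<p → cong (λ b → g t * ⟦ b ⟧) (scaledQR≡class c 0<c c<p t t<p)))

  Σ-squares : ∀ g → Σ< n (λ i → g (s i % p)) ≡ Σclass true g
  Σ-squares g = begin
    Σ< n (λ i → g (s i % p))        ≡⟨ Σ<-cong n (λ i _ → cong (λ z → g (z % p)) (*-identityˡ (s i))) ⟨
    Σ< n (λ i → g ((1 * s i) % p))  ≡⟨ Σ-scaled-class 1 (s≤s z≤n) 1<p g ⟩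
    Σclass (QR 1) g                 ≡⟨ cong (λ χ → Σclass χ g) QR-1 ⟩
    Σclass true g                   ∎
    where open ≡-Reasoning

  Σclass-true+false : Σclass true id + Σclass false id ≡ p * n
  Σclass-true+false = *-cancelˡ-≡ _ _ 2 (+-cancelʳ-≡ p _ _ (begin
    2 * (Σclass true id + Σclass false id) + p  ≡⟨ cong (λ z → 2 * z + p) residues+non-residues ⟩
    2 * Σ< p id + p                             ≡⟨ triangular p ⟩
    p * p                                       ≡⟨ cong (λ z → z * z) p≡2n+1 ⟩
    suc (n + n) * suc (n + n)                   ≡⟨ expand n ⟩
    2 * (suc (n + n) * n) + suc (n + n)         ≡⟨ cong (λ z → 2 * (z * n) + z) p≡2n+1 ⟨
    2 * (p * n) + p                             ∎))
    where
    open ≡-Reasoning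
    split : ∀ t → t * ⟦ QR t ⟧ + t * ⟦ NR t ⟧ ≡ t
    split zero    = refl
    split (suc t) with QR (suc t)
    ... | true  = trans (cong₂ _+_ (*-identityʳ (suc t)) (*-zeroʳ (suc t))) (+-identityʳ (suc t))
    ... | false = cong₂ _+_ (*-zeroʳ (suc t)) (*-identityʳ (suc t))
    residues+non-residues : Σclass true id + Σclass false id ≡ Σ< p id
    residues+non-residues = trans (sym (Σ<-+ p (λ t → t * ⟦ QR t ⟧) (λ t → t * ⟦ NR t ⟧))) (Σ<-cong p (λ t _ → split t))
    expand : ∀ n → suc (n + n) * suc (n + n) ≡ 2 * (suc (n + n) * n) + suc (n + n)
    expand = solve-∀

  -- The residue −1

  q*u≡p-u : ∀ u → 0 < u → u < p → (q * u) % p ≡ p ∸ u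
  q*u≡p-u (suc u) _ (s≤s u<q) = begin
    (q * suc u) % p           ≡⟨ cong (_% p) q*[1+u]≡ ⟩
    (q ∸ u + u * p) % p       ≡⟨ +-kp≡ₚ (q ∸ u) u ⟩
    (q ∸ u) % p               ≡⟨ <p⇒%≡ (s≤s (m∸n≤m q u)) ⟩
    q ∸ u                     ∎
    where
    open ≡-Reasoning
    expand : ∀ u r → (u + r) * suc u ≡ r + u * suc (u + r)
    expand = solve-∀
    q*[1+u]≡ : q * suc u ≡ q ∸ u + u * p
    q*[1+u]≡ = begin
      q * suc u                          ≡⟨ cong (_* suc u) (m+[n∸m]≡n (<⇒≤ u<q)) ⟨
      (u + (q ∸ u)) * suc u              ≡⟨ expand u (q ∸ u) ⟩
      q ∸ u + u * suc (u + (q ∸ u))      ≡⟨ cong (λ z → q ∸ u + u * suc z) (m+[n∸m]≡n (<⇒≤ u<q)) ⟩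
      q ∸ u + u * p                      ∎

  q*sᵢ≡p-sᵢ : ∀ {i} → i < n → (q * s i) % p ≡ p ∸ s i % p
  q*sᵢ≡p-sᵢ {i} i<n = trans (sym (*-congˡₚ q (%-idem (s i))))
                            (q*u≡p-u (s i % p) (n≢0⇒n>0 (s≢ₚ0 i<n)) (m%n<n (s i) p))

  Σ-squares+Σ-negated-squares : Σ< n (λ i → (q * s i) % p) + Σ< n (λ i → s i % p) ≡ n * p
  Σ-squares+Σ-negated-squares = begin
    Σ< n (λ i → (q * s i) % p) + Σ< n (λ i → s i % p)  ≡⟨ Σ<-+ n (λ i → (q * s i) % p) (λ i → s i % p) ⟨
    Σ< n (λ i → (q * s i) % p + s i % p)               ≡⟨ Σ<-cong n pairs ⟩
    Σ< n (λ _ → p)                                     ≡⟨ Σ<-const n p ⟩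
    n * p                                              ∎
    where
    open ≡-Reasoning
    pairs : ∀ i → i < n → (q * s i) % p + s i % p ≡ p
    pairs i i<n = trans (cong (_+ s i % p) (q*sᵢ≡p-sᵢ i<n)) (m∸n+n≡m (<⇒≤ (m%n<n (s i) p)))

  −1∈QR⇒Σclasses≡ : QR q ≡ true → Σclass true id ≡ Σclass false id
  −1∈QR⇒Σclasses≡ QRq = +-cancelˡ-≡ (Σclass true id) _ _ (begin
    Σclass true id + Σclass true id                      ≡⟨ cong₂ _+_ negated squares ⟨
    Σ< n (λ i → (q * s i) % p) + Σ< n (λ i → s i % p)  ≡⟨ Σ-squares+Σ-negated-squares ⟩
    n * p                                              ≡⟨ *-comm n p ⟩
    p * n                                              ≡⟨ Σclass-true+false ⟨
    Σclass true id + Σclass false id                     ∎)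
    where
    open ≡-Reasoning
    squares : Σ< n (λ i → s i % p) ≡ Σclass true id
    squares = Σ-squares id
    negated : Σ< n (λ i → (q * s i) % p) ≡ Σclass true id
    negated = trans (Σ-scaled-class q 1≤q ≤-refl id) (cong (λ χ → Σclass χ id) QRq)

  n-odd⇒Σclasses≢ : ∀ a → n ≡ suc (2 * a) → Σclass true id ≢ Σclass false id
  n-odd⇒Σclasses≢ a n≡2a+1 F≡G = even≢odd F (a + n * n) (begin
    2 * F                                          ≡⟨ cong (_+_ F) (+-identityʳ F) ⟩
    F + F                                          ≡⟨ cong (_+_ F) F≡G ⟩
    F + Σclass false id                            ≡⟨ Σclass-true+false ⟩
    p * n                                          ≡⟨ cong (_* n) p≡2n+1 ⟩
    suc (n + n) * n                                ≡⟨ cong (λ m → suc (m + m) * m) n≡2a+1 ⟩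
    suc (suc (2 * a) + suc (2 * a)) * suc (2 * a)  ≡⟨ expand a ⟩
    suc (2 * (a + suc (2 * a) * suc (2 * a)))      ≡⟨ cong (λ m → suc (2 * (a + m * m))) n≡2a+1 ⟨
    suc (2 * (a + n * n))                          ∎)
    where
    open ≡-Reasoning
    F = Σclass true id
    expand : ∀ a → suc (suc (2 * a) + suc (2 * a)) * suc (2 * a) ≡ suc (2 * (a + suc (2 * a) * suc (2 * a)))
    expand = solve-∀

  n-odd⇒−1∉QR : ∀ a → n ≡ suc (2 * a) → QR q ≡ false
  n-odd⇒−1∉QR a n≡2a+1 = ¬-not (λ QRq → n-odd⇒Σclasses≢ a n≡2a+1 (−1∈QR⇒Σclasses≡ QRq))

  -- If −1 is not a residue, inversion pairs off the residues other than 1.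
  module InversePairing (−1∉QR : QR q ≡ false) where

    R : ℕ → Bool
    R t = QR t ∧ not (1 ≡ᵇ t)

    inv-involution : FixedPointFreeInvolution p R inv
    inv-involution t t<p Rt with ∧-true {QR t} Rt
    ... | QRt , t≢1ᵇ = inv<p t , R-inv , inv-involutive t t<p t≢0 , inv≢id
      where
      t≢0 : t % p ≢ 0
      t≢0 = QR⇒≢ₚ0 QRt
      t≢1 : t ≢ 1
      t≢1 t≡1 = ≡ᵇ-false⇒≢ (not-injective t≢1ᵇ) (sym t≡1)
      inv≢id : inv t ≢ t
      inv≢id t⁻¹≡t with inv-fixed⇒±1 t t<p t≢0 t⁻¹≡t
      ... | inj₁ t≡1 = t≢1 t≡1
      ... | inj₂ t≡q = not-¬ −1∉QR (subst (λ u → QR u ≡ true) t≡q QRt)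
      R-inv : R (inv t) ≡ true
      R-inv = subst (λ b → (b ∧ not (1 ≡ᵇ inv t)) ≡ true) (sym (QR-inv t QRt))
                (cong not (≢⇒≡ᵇ-false (λ 1≡t⁻¹ → t≢1 (inv≡1⇒≡1 t t<p t≢0 (sym 1≡t⁻¹)))))

    count-R : count p R + 1 ≡ n
    count-R = begin
      count p R + 1                                               ≡⟨ +-comm (count p R) 1 ⟩
      1 + count p R                                               ≡⟨ cong (_+ count p R) count-QR∧1 ⟨
      count p (λ t → QR t ∧ (1 ≡ᵇ t)) + count p R                 ≡⟨ count-split p QR (1 ≡ᵇ_) ⟨
      count p QR                                                  ≡⟨ count-QR ⟩
      n                                                           ∎
      where
      open ≡-Reasoning
      count-QR∧1 : count p (λ t → QR t ∧ (1 ≡ᵇ t)) ≡ 1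
      count-QR∧1 = begin
        count p (λ t → QR t ∧ (1 ≡ᵇ t))         ≡⟨ Σ<-cong p (λ t _ → only-1 t) ⟩
        Σ< p (λ t → 1 * ⟦ 1 ≡ᵇ t ⟧)             ≡⟨ Σ<-δ p (λ _ → 1) 1 1<p ⟩
        1                                       ∎
        where
        only-1 : ∀ t → ⟦ QR t ∧ (1 ≡ᵇ t) ⟧ ≡ 1 * ⟦ 1 ≡ᵇ t ⟧
        only-1 0             = cong (λ b → ⟦ b ∧ false ⟧) QR-0
        only-1 1             = cong (λ b → ⟦ b ∧ true ⟧) QR-1
        only-1 (suc (suc t)) = cong ⟦_⟧ (∧-zeroʳ (QR (suc (suc t))))

    n-odd : n ≡ suc (2 * count p (below-orbit inv-involution))
    n-odd = trans (sym count-R) (trans (cong (_+ 1) (count-involution {p} {R} {inv} inv-involution)) (+-comm _ 1))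

  n-even⇒−1∈QR : ∀ a → n ≡ 2 * a → QR q ≡ true
  n-even⇒−1∈QR a n≡2a with QR q in QRq
  ... | true  = refl
  ... | false = ⊥-elim (even≢odd a (count p (below-orbit inv-involution)) (trans (sym n≡2a) n-odd))
    where open InversePairing QRq

  −1∉QR⇒QR-negate : QR q ≡ false → ∀ u → 0 < u → u < p → QR (p ∸ u) ≡ not (QR u)
  −1∉QR⇒QR-negate −1∉QR u 0<u u<p = begin
    QR (p ∸ u)                 ≡⟨ not-involutive (QR (p ∸ u)) ⟨
    not (not (QR (p ∸ u)))     ≡⟨ cong (λ b → not (not b ∧ not (QR (p ∸ u)))) (≢⇒≡ᵇ-false {p ∸ u} p-u≢0) ⟨
    not (NR (p ∸ u))           ≡⟨ cong (λ χ → not (class χ (p ∸ u))) −1∉QR ⟨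
    not (class (QR q) (p ∸ u)) ≡⟨ cong not (scaledQR≡class q 1≤q ≤-refl (p ∸ u) p-u<p) ⟨
    not (scaledQR q (p ∸ u))   ≡⟨ cong not (any<-cong n negated-square≡) ⟩
    not (QR u)                 ∎
    where
    open ≡-Reasoning
    p-u<p : p ∸ u < p
    p-u<p = ∸-monoʳ-< 0<u (<⇒≤ u<p)
    p-u≢0 : p ∸ u ≢ 0
    p-u≢0 p-u≡0 = ≤⇒≯ (m∸n≡0⇒m≤n p-u≡0) u<p
    negated-square≡ : ∀ i → i < n → ((q * s i) % p ≡ᵇ p ∸ u) ≡ (s i % p ≡ᵇ u)
    negated-square≡ i i<n = ⇔→≡ (mk⇔
      (λ e → ≡⇒≡ᵇ-true (∸-injective (trans (sym (q*sᵢ≡p-sᵢ i<n)) (≡ᵇ-true {(q * s i) % p} e))))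
      (λ e → ≡⇒≡ᵇ-true (trans (q*sᵢ≡p-sᵢ i<n) (cong (p ∸_) (≡ᵇ-true {s i % p} e)))))
      where
      ∸-injective : p ∸ s i % p ≡ p ∸ u → s i % p ≡ u
      ∸-injective e = trans (sym (m∸[m∸n]≡n (<⇒≤ (m%n<n (s i) p)))) (trans (cong (p ∸_) e) (m∸[m∸n]≡n (<⇒≤ u<p)))

  -- The counting identity

  -- p + 1 − k represents 1 − k, and lies in [2, p) when 1 < k < p.
  oneMinus : ℕ → ℕ
  oneMinus k = suc p ∸ k

  k+oneMinus≡1+p : ∀ {k} → k < p → k + oneMinus k ≡ suc p
  k+oneMinus≡1+p k<p = m+[n∸m]≡n (<⇒≤ (<-trans k<p (n<1+n p)))

  1<oneMinus : ∀ {k} → 1 < k → k < p → 1 < oneMinus k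
  1<oneMinus {suc (suc k)} (s≤s (s≤s z≤n)) (s≤s k+1<q) = subst (_≤ q ∸ k) (m+n∸n≡m 2 k) (∸-monoˡ-≤ k k+1<q)

  oneMinus<p : ∀ {k} → 1 < k → k < p → oneMinus k < p
  oneMinus<p {suc (suc k)} (s≤s (s≤s z≤n)) _ = s≤s (m∸n≤m q k)

  oneMinus-involutive : ∀ {k} → 1 < k → k < p → oneMinus (oneMinus k) ≡ k
  oneMinus-involutive {k} 1<k k<p = +-cancelˡ-≡ (oneMinus k) _ _ (begin
    oneMinus k + oneMinus (oneMinus k)  ≡⟨ k+oneMinus≡1+p (oneMinus<p 1<k k<p) ⟩
    suc p                               ≡⟨ k+oneMinus≡1+p k<p ⟨
    k + oneMinus k                      ≡⟨ +-comm k (oneMinus k) ⟩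
    oneMinus k + k                      ∎)
    where open ≡-Reasoning

  below : ℕ → ℕ → ℕ → Bool
  below k r i = (k * s i + r) % p <ᵇ (s i + r) % p

  N M : ℕ → ℕ → ℕ
  N k r = count n (below k r)
  M k r = count n (λ i → not (below k r i))

  N+M≡n : ∀ k r → N k r + M k r ≡ n
  N+M≡n k r = begin
    N k r + M k r                                     ≡⟨ Σ<-+ n (λ i → ⟦ below k r i ⟧) (λ i → ⟦ not (below k r i) ⟧) ⟨
    Σ< n (λ i → ⟦ below k r i ⟧ + ⟦ not (below k r i) ⟧) ≡⟨ Σ<-cong n (λ i _ → one (below k r i)) ⟩
    Σ< n (λ _ → 1)                                     ≡⟨ Σ<-const n 1 ⟩
    n * 1                                              ≡⟨ *-identityʳ n ⟩
    n                                                  ∎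
    where
    open ≡-Reasoning
    one : ∀ b → ⟦ b ⟧ + ⟦ not b ⟧ ≡ 1
    one true  = refl
    one false = refl

  shift : ℕ → ℕ → ℕ
  shift r t = (t + r) % p

  +oneMinus≡ₚ : ∀ {k} → k < p → ∀ x r → k * x + r + oneMinus k * x ≡ₚ x + r
  +oneMinus≡ₚ {k} k<p x r = begin
    (k * x + r + oneMinus k * x) % p  ≡⟨ cong (_% p) (regroup k (oneMinus k) x r) ⟩
    ((k + oneMinus k) * x + r) % p    ≡⟨ cong (λ z → (z * x + r) % p) (k+oneMinus≡1+p k<p) ⟩
    (suc p * x + r) % p               ≡⟨ cong (_% p) (expand p x r) ⟩
    (x + r + x * p) % p               ≡⟨ +-kp≡ₚ (x + r) x ⟩
    (x + r) % p                       ∎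
    where
    open ≡-Reasoning
    regroup : ∀ k k̄ x r → k * x + r + k̄ * x ≡ (k + k̄) * x + r
    regroup = solve-∀
    expand : ∀ p x r → suc p * x + r ≡ x + r + x * p
    expand = solve-∀

  Σ-oneMinus : ℕ → ℕ
  Σ-oneMinus k = Σclass (QR (oneMinus k)) id

  counting-identity : ∀ {k} r → 1 < k → k < p →
    Σclass true (shift r) + p * M k r ≡ Σclass (QR k) (shift r) + Σ-oneMinus k
  counting-identity {k} r 1<k k<p = begin
    Σclass true (shift r) + p * M k r                ≡⟨ cong₂ _+_ (Σ-squares (shift r)) (Σ<-*ˡ n p (λ i → ⟦ not (below k r i) ⟧)) ⟨
    Σ< n B + Σ< n (λ i → p * ⟦ not (below k r i) ⟧)  ≡⟨ Σ<-+ n B (λ i → p * ⟦ not (below k r i) ⟧) ⟨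
    Σ< n (λ i → B i + p * ⟦ not (below k r i) ⟧)     ≡⟨ Σ<-cong n wrap ⟩
    Σ< n (λ i → A i + C i)                           ≡⟨ Σ<-+ n A C ⟩
    Σ< n A + Σ< n C                                  ≡⟨ cong₂ _+_ (Σ-scaled-class k 0<k k<p (shift r))
                                                                   (Σ-scaled-class (oneMinus k) 0<k̄ k̄<p id) ⟩
    Σclass (QR k) (shift r) + Σ-oneMinus k           ∎
    where
    open ≡-Reasoning
    0<k = <-trans (s≤s z≤n) 1<k
    0<k̄ = <-trans (s≤s z≤n) (1<oneMinus 1<k k<p)
    k̄<p = oneMinus<p 1<k k<p
    A B C : ℕ → ℕ
    A i = shift r ((k * s i) % p)
    B i = shift r (s i % p)
    C i = (oneMinus k * s i) % p
    A≡ : ∀ i → A i ≡ (k * s i + r) % p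
    A≡ i = +-congₚ {(k * s i) % p} {k * s i} {r} (%-idem (k * s i)) refl
    B≡ : ∀ i → B i ≡ (s i + r) % p
    B≡ i = +-congₚ {s i % p} {s i} {r} (%-idem (s i)) refl
    A+C≡B : ∀ i → (A i + C i) % p ≡ B i
    A+C≡B i = begin
      (A i + C i) % p                       ≡⟨ +-congₚ {A i} {k * s i + r} (trans (cong (_% p) (A≡ i)) (%-idem (k * s i + r)))
                                                                         (%-idem (oneMinus k * s i)) ⟩
      (k * s i + r + oneMinus k * s i) % p  ≡⟨ +oneMinus≡ₚ k<p (s i) r ⟩
      (s i + r) % p                         ≡⟨ B≡ i ⟨
      B i                                   ∎
    wrap : ∀ i → i < n → B i + p * ⟦ not (below k r i) ⟧ ≡ A i + C i
    wrap i i<n = subst₂ (λ a b → B i + p * ⟦ not (a <ᵇ b) ⟧ ≡ A i + C i) (A≡ i) (B≡ i)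
      (+-%-wrap p (A i) (B i) (C i) (m%n<n ((k * s i) % p + r) p) (m%n<n (oneMinus k * s i) p)
        (n≢0⇒n>0 (*-nonzeroₚ (oneMinus k) (s i) (0<x<p⇒≢ₚ0 0<k̄ k̄<p) (s≢ₚ0 i<n))) (A+C≡B i))

  N≡⇔M≡ : ∀ k r k′ r′ → N k r ≡ N k′ r′ ⇔ M k r ≡ M k′ r′
  N≡⇔M≡ k r k′ r′ = mk⇔
    (λ N≡N′ → +-cancelˡ-≡ (N k r) _ _ (trans (N+M≡n k r) (sym (trans (cong (_+ M k′ r′) N≡N′) (N+M≡n k′ r′)))))
    (λ M≡M′ → +-cancelʳ-≡ (M k′ r′) _ _ (trans (cong (_+_ (N k r)) (sym M≡M′)) (trans (N+M≡n k r) (sym (N+M≡n k′ r′)))))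

  N≡⇔Σ-oneMinus≡ : ∀ {k k′} r → 1 < k → k < p → 1 < k′ → k′ < p → QR k ≡ QR k′ →
    N k r ≡ N k′ r ⇔ Σ-oneMinus k ≡ Σ-oneMinus k′
  N≡⇔Σ-oneMinus≡ {k} {k′} r 1<k k<p 1<k′ k′<p QRk≡QRk′ = mk⇔
    (λ N≡N′ → sym (+-cancelˡ-≡ (p * M k r) _ _
                  (trans cross (cong (λ m → p * m + Σ-oneMinus k) (sym (Equivalence.to (N≡⇔M≡ k r k′ r) N≡N′))))))
    (λ C≡C′ → Equivalence.from (N≡⇔M≡ k r k′ r)
                  (*-cancelˡ-≡ _ _ p (+-cancelʳ-≡ (Σ-oneMinus k′) _ _ (trans cross (cong (_+_ (p * M k′ r)) C≡C′)))))
    where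
    open ≡-Reasoning
    Bᵣ = Σclass true (shift r)
    Aₖ = Σclass (QR k) (shift r)
    cross : p * M k r + Σ-oneMinus k′ ≡ p * M k′ r + Σ-oneMinus k
    cross = +-cancelˡ-≡ Bᵣ _ _ (begin
      Bᵣ + (p * M k r + Σ-oneMinus k′)     ≡⟨ +-assoc Bᵣ _ _ ⟨
      (Bᵣ + p * M k r) + Σ-oneMinus k′     ≡⟨ cong (_+ Σ-oneMinus k′) (counting-identity r 1<k k<p) ⟩
      (Aₖ + Σ-oneMinus k) + Σ-oneMinus k′  ≡⟨ +-assoc Aₖ _ _ ⟩
      Aₖ + (Σ-oneMinus k + Σ-oneMinus k′)  ≡⟨ cong (_+_ Aₖ) (+-comm (Σ-oneMinus k) _) ⟩
      Aₖ + (Σ-oneMinus k′ + Σ-oneMinus k)  ≡⟨ +-assoc Aₖ _ _ ⟨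
      (Aₖ + Σ-oneMinus k′) + Σ-oneMinus k  ≡⟨ cong (λ χ → (Σclass χ (shift r) + Σ-oneMinus k′) + Σ-oneMinus k) QRk≡QRk′ ⟩
      (Σclass (QR k′) (shift r) + Σ-oneMinus k′) + Σ-oneMinus k
                                           ≡⟨ cong (_+ Σ-oneMinus k) (counting-identity r 1<k′ k′<p) ⟨
      (Bᵣ + p * M k′ r) + Σ-oneMinus k     ≡⟨ +-assoc Bᵣ _ _ ⟩
      Bᵣ + (p * M k′ r + Σ-oneMinus k)     ∎)

  N-shift-invariant : ∀ {k} r r′ → 1 < k → k < p → QR k ≡ true → N k r ≡ N k r′
  N-shift-invariant {k} r r′ 1<k k<p QRk = Equivalence.from (N≡⇔M≡ k r k r′) (*-cancelˡ-≡ _ _ p (trans (pM≡ r) (sym (pM≡ r′))))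
    where
    pM≡ : ∀ r → p * M k r ≡ Σ-oneMinus k
    pM≡ r = +-cancelˡ-≡ (Σclass true (shift r)) _ _
      (trans (counting-identity r 1<k k<p) (cong (λ χ → Σclass χ (shift r) + Σ-oneMinus k) QRk))

  -- Quadratic characters of k and 1 − k

  Pattern : Bool → Bool → Set
  Pattern χ ψ = ∃ λ k → 1 < k × k < p × QR k ≡ χ × QR (oneMinus k) ≡ ψ

  Pattern-swap : ∀ {χ ψ} → Pattern χ ψ → Pattern ψ χ
  Pattern-swap (k , 1<k , k<p , QRk , QRk̄) =
    oneMinus k , 1<oneMinus 1<k k<p , oneMinus<p 1<k k<p , QRk̄ , trans (cong QR (oneMinus-involutive 1<k k<p)) QRk

  module Patterns (−1∉QR : QR q ≡ false) where

    QR-oneMinus : ∀ k → 1 < k → k < p → QR (oneMinus k) ≡ not (QR (k ∸ 1))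
    QR-oneMinus (suc k) (s≤s 0<k) k+1<p = −1∉QR⇒QR-negate −1∉QR k 0<k (<-trans (n<1+n k) k+1<p)

    pattern-at : ∀ k → 1 < k → k < p → Pattern (QR k) (not (QR (k ∸ 1)))
    pattern-at k 1<k k<p = k , 1<k , k<p , refl , QR-oneMinus k 1<k k<p

    descent : ∃ λ t → 1 ≤ t × t < q × QR t ≡ true × QR (suc t) ≡ false
    descent with true-false-transition QR 1 (q ∸ 1) QR-1 (trans (cong QR (m+[n∸m]≡n 1≤q)) −1∉QR)
    ... | t , 1≤t , t<1+[q-1] , QRt , QR[1+t] = t , 1≤t , subst (t <_) (m+[n∸m]≡n 1≤q) t<1+[q-1] , QRt , QR[1+t]

    ascent⇒Pattern-TT : ∀ a b → 1 ≤ a → a ≤ b → b < p → QR a ≡ false → QR b ≡ true → Pattern true true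
    ascent⇒Pattern-TT a b 1≤a a≤b b<p QRa QRb
      with true-false-transition (λ x → not (QR x)) a (b ∸ a) (cong not QRa) (cong not (trans (cong QR (m+[n∸m]≡n a≤b)) QRb))
    ... | j , a≤j , j<b , ¬QRj , ¬QR[1+j] =
      subst₂ Pattern (not-injective ¬QR[1+j]) (cong not (not-injective ¬QRj)) (pattern-at (suc j) (s≤s (≤-trans 1≤a a≤j)) 1+j<p)
      where
      1+j<p : suc j < p
      1+j<p = ≤-<-trans (subst (j <_) (m+[n∸m]≡n a≤b) j<b) b<p

    Pattern-FF : Pattern false false
    Pattern-FF with descent
    ... | t , 1≤t , t<q , QRt , QR[1+t] = subst₂ Pattern QR[1+t] (cong not QRt) (pattern-at (suc t) (s≤s 1≤t) (s≤s t<q))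

    -- If 2 is a residue, the first switch t ↦ t + 1 from residue to non-residue is followed by a
    -- switch back within [t + 1, 2t], or within [p − t, t] when 2t ≥ p.
    Pattern-TT : Pattern true true
    Pattern-TT with QR 2 in QR2
    ... | false = ascent⇒Pattern-TT 2 4 (s≤s z≤n) (s≤s (s≤s z≤n)) 4<p QR2 QR-4
    ... | true with descent
    ...   | t , 1≤t , t<q , QRt , QR[1+t] with t + t <? p
    ...     | yes 2t<p = ascent⇒Pattern-TT (suc t) (t + t) (s≤s z≤n) (+-monoˡ-≤ t 1≤t) 2t<p QR[1+t] QR[2t]
      where
      QR[2t] : QR (t + t) ≡ true
      QR[2t] = subst (λ u → QR u ≡ true) (trans (cong (_% p) (double t)) (<p⇒%≡ 2t<p)) (QR-* QR2 QRt)
        where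
        double : ∀ t → 2 * t ≡ t + t
        double = solve-∀
    ...     | no  2t≮p = ascent⇒Pattern-TT (p ∸ t) t (m<n⇒0<n∸m t<p) p-t≤t t<p
                           (trans (−1∉QR⇒QR-negate −1∉QR t 1≤t t<p) (cong not QRt)) QRt
      where
      t<p = <-trans t<q (n<1+n q)
      p-t≤t : p ∸ t ≤ t
      p-t≤t = subst (p ∸ t ≤_) (m+n∸n≡m t t) (∸-monoˡ-≤ t (≮⇒≥ 2t≮p))

    Pattern-TF⊎FT : Pattern true false ⊎ Pattern false true
    Pattern-TF⊎FT with QR 2 in QR2 | QR 3 in QR3
    ... | true  | _     = inj₁ (subst₂ Pattern QR2 (cong not QR-1) (pattern-at 2 (s≤s (s≤s z≤n)) 2<p))
      where 2<p = <-trans (s≤s (s≤s (s≤s z≤n))) 4<p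
    ... | false | true  = inj₁ (subst₂ Pattern QR-4 (cong not QR3) (pattern-at 4 (s≤s (s≤s z≤n)) 4<p))
    ... | false | false = inj₂ (subst₂ Pattern QR3 (cong not QR2) (pattern-at 3 (s≤s (s≤s z≤n)) (<-trans (n<1+n 3) 4<p)))

    Pattern-TF : Pattern true false
    Pattern-TF with Pattern-TF⊎FT
    ... | inj₁ tf = tf
    ... | inj₂ ft = Pattern-swap ft

    Pattern-FT : Pattern false true
    Pattern-FT = Pattern-swap Pattern-TF

  -- The sets S and T

  sign : Bool → ℤ
  sign χ = if χ then + 1 else -[1+ 0 ]

  sign-injective : ∀ {χ ψ} → sign χ ≡ sign ψ → χ ≡ ψ
  sign-injective {true}  {true}  _ = refl
  sign-injective {false} {false} _ = refl

  any-square≡QR : ∀ k → 0 < k → k < p → any< p (λ x → sq x % p ≡ᵇ k) ≡ QR k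
  any-square≡QR k 0<k k<p = ⇔→≡ (mk⇔ hit⇒QR QR⇒hit)
    where
    hit⇒QR : any< p (λ x → sq x % p ≡ᵇ k) ≡ true → QR k ≡ true
    hit⇒QR e with any<-witness p _ e
    ... | x , x<p , x²≡k with ≡ᵇ-true {sq x % p} x²≡k
    ...   | x²%p≡k = subst (λ u → QR u ≡ true) x²%p≡k (QR-sq x x≢0)
      where
      x≢0 : x % p ≢ 0
      x≢0 x≡0 = <⇒≢ 0<k (trans (sym (*-congₚ {x} {0} {x} {0} x≡0 x≡0)) x²%p≡k)
    QR⇒hit : QR k ≡ true → any< p (λ x → sq x % p ≡ᵇ k) ≡ true
    QR⇒hit e with QR-witness e
    ... | i , i<n , sᵢ≡k = any<-intro p (λ x → sq x % p ≡ᵇ k) (suc i) (i<n⇒1+i<p i<n) (≡⇒≡ᵇ-true sᵢ≡k)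

  legendre≡sign-QR : ∀ k → 0 < k → k < p → legendre (+ k) p ≡ sign (QR k)
  legendre≡sign-QR k@(suc _) 0<k k<p = begin
    legendre (+ k) p                                          ≡⟨ cong symbol (<p⇒%≡ k<p) ⟩
    sign (any (λ x → sq x % p ≡ᵇ k) (upTo p))                 ≡⟨ cong sign (any-applyUpTo (λ x → sq x % p ≡ᵇ k) id p) ⟩
    sign (any< p (λ x → sq x % p ≡ᵇ k))                       ≡⟨ cong sign (any-square≡QR k 0<k k<p) ⟩
    sign (QR k)                                               ∎
    where
    open ≡-Reasoning
    symbol : ℕ → ℤ
    symbol z = if z ≡ᵇ 0 then + 0 else sign (any (λ x → sq x % p ≡ᵇ z) (upTo p))

  Np≡N : ∀ k b → Np p (+ k) b ≡ N k (b %ℕ p)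
  Np≡N k b = begin
    Np p (+ k) b                                     ≡⟨ cong (λ xs → length (filter below? xs)) (map-applyUpTo id suc n) ⟩
    length (filter below? (applyUpTo suc n))         ≡⟨ length-filter-applyUpTo below? suc n ⟩
    count n (λ i → does (below? (suc i)))            ≡⟨ Σ<-cong n (λ i _ → cong₂ (λ a c → ⟦ a <ᵇ c ⟧) (A≡ i) (B≡ i)) ⟩
    N k (b %ℕ p)                                     ∎
    where
    open ≡-Reasoning
    below? = λ x → res (+ k ℤ.* + (x * x) ℤ.+ b) p <? res (+ (x * x) ℤ.+ b) p
    A≡ : ∀ i → res (+ k ℤ.* + s i ℤ.+ b) p ≡ (k * s i + b %ℕ p) % p
    A≡ i = trans (cong (λ z → (z ℤ.+ b) %ℕ p) (sym (pos-* k (s i)))) ([m+b]%ℕ≡[m+b%ℕ]% (k * s i) b)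
    B≡ : ∀ i → res (+ s i ℤ.+ b) p ≡ (s i + b %ℕ p) % p
    B≡ i = [m+b]%ℕ≡[m+b%ℕ]% (s i) b

  InSet⇒ : ∀ {χ b v} → InSet p (sign χ) b v → ∃ λ k → 1 < k × k < p × QR k ≡ χ × N k (b %ℕ p) ≡ v
  InSet⇒ {b = b} (+ k , ℤ.+<+ 1<k , ℤ.+<+ k<p , ε≡χ , Np≡v) =
    k , 1<k , k<p , sign-injective (trans (sym (legendre≡sign-QR k (<-trans (s≤s z≤n) 1<k) k<p)) ε≡χ) ,
    trans (sym (Np≡N k b)) Np≡v

  ⇒InSet : ∀ {χ} b {k} → 1 < k → k < p → QR k ≡ χ → InSet p (sign χ) b (N k (b %ℕ p))
  ⇒InSet b {k} 1<k k<p QRk≡χ =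
    + k , ℤ.+<+ 1<k , ℤ.+<+ k<p , trans (legendre≡sign-QR k (<-trans (s≤s z≤n) 1<k) k<p) (cong sign QRk≡χ) , Np≡N k b

  Σ-oneMinus≡⇒N≡ : ∀ {k k′} r → 1 < k → k < p → 1 < k′ → k′ < p →
    QR k ≡ QR k′ → Σ-oneMinus k ≡ Σ-oneMinus k′ → N k r ≡ N k′ r
  Σ-oneMinus≡⇒N≡ r 1<k k<p 1<k′ k′<p QRk≡QRk′ = Equivalence.from (N≡⇔Σ-oneMinus≡ r 1<k k<p 1<k′ k′<p QRk≡QRk′)

  same-pattern⇒N≡ : ∀ {k k′} r → 1 < k → k < p → 1 < k′ → k′ < p →
    QR k ≡ QR k′ → QR (oneMinus k) ≡ QR (oneMinus k′) → N k r ≡ N k′ r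
  same-pattern⇒N≡ r 1<k k<p 1<k′ k′<p QRk≡QRk′ QRk̄≡QRk̄′ =
    Σ-oneMinus≡⇒N≡ r 1<k k<p 1<k′ k′<p QRk≡QRk′ (cong (λ χ → Σclass χ id) QRk̄≡QRk̄′)

  exactly-one : ∀ {χ} b → (∃ λ k₀ → 1 < k₀ × k₀ < p × QR k₀ ≡ χ) →
    (∀ k k′ → Σ-oneMinus k ≡ Σ-oneMinus k′) → HasExactly1 (InSet p (sign χ) b)
  exactly-one {χ} b (k₀ , 1<k₀ , k₀<p , QRk₀) Σ-oneMinus-const = N k₀ (b %ℕ p) , ⇒InSet b 1<k₀ k₀<p QRk₀ , unique
    where
    unique : ∀ v → InSet p (sign χ) b v → v ≡ N k₀ (b %ℕ p)
    unique v v∈S with InSet⇒ v∈S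
    ... | k , 1<k , k<p , QRk , refl =
      Σ-oneMinus≡⇒N≡ (b %ℕ p) 1<k k<p 1<k₀ k₀<p (trans QRk (sym QRk₀)) (Σ-oneMinus-const k k₀)

  exactly-two : ∀ {χ} b → Pattern χ true → Pattern χ false →
    Σclass true id ≢ Σclass false id → HasExactly2 (InSet p (sign χ) b)
  exactly-two {χ} b (k₁ , 1<k₁ , k₁<p , QRk₁ , QRk̄₁) (k₂ , 1<k₂ , k₂<p , QRk₂ , QRk̄₂) F≢G =
    N k₁ r , N k₂ r , N₁≢N₂ , ⇒InSet b 1<k₁ k₁<p QRk₁ , ⇒InSet b 1<k₂ k₂<p QRk₂ , one-of-two
    where
    r : ℕ
    r = b %ℕ p
    N₁≢N₂ : N k₁ r ≢ N k₂ r
    N₁≢N₂ N₁≡N₂ = F≢G (begin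
      Σclass true id             ≡⟨ cong (λ ψ → Σclass ψ id) QRk̄₁ ⟨
      Σ-oneMinus k₁              ≡⟨ Equivalence.to (N≡⇔Σ-oneMinus≡ r 1<k₁ k₁<p 1<k₂ k₂<p (trans QRk₁ (sym QRk₂))) N₁≡N₂ ⟩
      Σ-oneMinus k₂              ≡⟨ cong (λ ψ → Σclass ψ id) QRk̄₂ ⟩
      Σclass false id            ∎)
      where open ≡-Reasoning
    by-pattern : ∀ {k} ψ → 1 < k → k < p → QR k ≡ χ → QR (oneMinus k) ≡ ψ → N k r ≡ N k₁ r ⊎ N k r ≡ N k₂ r
    by-pattern true  1<k k<p QRk QRk̄ = inj₁ (same-pattern⇒N≡ r 1<k k<p 1<k₁ k₁<p (trans QRk (sym QRk₁)) (trans QRk̄ (sym QRk̄₁)))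
    by-pattern false 1<k k<p QRk QRk̄ = inj₂ (same-pattern⇒N≡ r 1<k k<p 1<k₂ k₂<p (trans QRk (sym QRk₂)) (trans QRk̄ (sym QRk̄₂)))
    one-of-two : ∀ v → InSet p (sign χ) b v → v ≡ N k₁ r ⊎ v ≡ N k₂ r
    one-of-two v v∈S with InSet⇒ v∈S
    ... | k , 1<k , k<p , QRk , refl = by-pattern (QR (oneMinus k)) 1<k k<p QRk refl

  NR⇒nonresidue : ∀ t → t < p → NR t ≡ true → 1 < t × t < p × QR t ≡ false
  NR⇒nonresidue 0             _   ()
  NR⇒nonresidue 1             _   NR1 = ⊥-elim (not-¬ (cong not QR-1) NR1)
  NR⇒nonresidue (suc (suc k)) t<p NRt = s≤s (s≤s z≤n) , t<p , not-injective NRt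

  nonresidue : ∃ λ k → 1 < k × k < p × QR k ≡ false
  nonresidue = let t , t<p , NRt = count>0⇒witness p NR 0<count in t , NR⇒nonresidue t t<p NRt
    where
    0<count : 0 < count p NR
    0<count = subst (0 <_) (sym count-NR) (<-≤-trans (s≤s z≤n) 2≤n)

  residue : ∃ λ k → 1 < k × k < p × QR k ≡ true
  residue = 4 , s≤s (s≤s z≤n) , 4<p , QR-4

  p≡1[4]⇒n-even : p % 4 ≡ 1 → n ≡ 2 * (p / 4)
  p≡1[4]⇒n-even p%4≡1 = *-cancelˡ-≡ n (2 * (p / 4)) 2 (suc-injective (begin
    suc (2 * n)             ≡⟨ cong suc (double n) ⟩
    suc (n + n)             ≡⟨ p≡2n+1 ⟨
    p                       ≡⟨ m≡m%n+[m/n]*n p 4 ⟩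
    p % 4 + p / 4 * 4       ≡⟨ cong (_+ p / 4 * 4) p%4≡1 ⟩
    suc (p / 4 * 4)         ≡⟨ cong suc (quadruple (p / 4)) ⟩
    suc (2 * (2 * (p / 4))) ∎))
    where
    open ≡-Reasoning
    double : ∀ n → 2 * n ≡ n + n
    double = solve-∀
    quadruple : ∀ m → m * 4 ≡ 2 * (2 * m)
    quadruple = solve-∀

  p≡3[4]⇒n-odd : p % 4 ≡ 3 → n ≡ suc (2 * (p / 4))
  p≡3[4]⇒n-odd p%4≡3 = *-cancelˡ-≡ n (suc (2 * (p / 4))) 2 (suc-injective (begin
    suc (2 * n)             ≡⟨ cong suc (double n) ⟩
    suc (n + n)             ≡⟨ p≡2n+1 ⟨
    p                       ≡⟨ m≡m%n+[m/n]*n p 4 ⟩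
    p % 4 + p / 4 * 4       ≡⟨ cong (_+ p / 4 * 4) p%4≡3 ⟩
    3 + p / 4 * 4           ≡⟨ regroup (p / 4) ⟩
    suc (2 * suc (2 * (p / 4))) ∎))
    where
    open ≡-Reasoning
    double : ∀ n → 2 * n ≡ n + n
    double = solve-∀
    regroup : ∀ m → 3 + m * 4 ≡ suc (2 * suc (2 * m))
    regroup = solve-∀

  Σclass-collapse : Σclass true id ≡ Σclass false id → ∀ χ → Σclass χ id ≡ Σclass true id
  Σclass-collapse F≡G true  = refl
  Σclass-collapse F≡G false = sym F≡G

  −1∈QR⇒Σ-oneMinus-const : QR q ≡ true → ∀ k k′ → Σ-oneMinus k ≡ Σ-oneMinus k′
  −1∈QR⇒Σ-oneMinus-const −1∈QR k k′ =
    trans (Σclass-collapse F≡G (QR (oneMinus k))) (sym (Σclass-collapse F≡G (QR (oneMinus k′))))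
    where
    F≡G : Σclass true id ≡ Σclass false id
    F≡G = −1∈QR⇒Σclasses≡ −1∈QR

  p≡1[4]⇒one-value : p % 4 ≡ 1 → ∀ b → HasExactly1 (InSet p (+ 1) b) × HasExactly1 (InSet p -[1+ 0 ] b)
  p≡1[4]⇒one-value p%4≡1 b = exactly-one b residue Σ-oneMinus-const , exactly-one b nonresidue Σ-oneMinus-const
    where
    Σ-oneMinus-const : ∀ k k′ → Σ-oneMinus k ≡ Σ-oneMinus k′
    Σ-oneMinus-const = −1∈QR⇒Σ-oneMinus-const (n-even⇒−1∈QR (p / 4) (p≡1[4]⇒n-even p%4≡1))

  p≡3[4]⇒two-values : p % 4 ≡ 3 → ∀ b → HasExactly2 (InSet p (+ 1) b) × HasExactly2 (InSet p -[1+ 0 ] b)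
  p≡3[4]⇒two-values p%4≡3 b =
    exactly-two b Pattern-TT Pattern-TF F≢G , exactly-two b Pattern-FT Pattern-FF F≢G
    where
    n≡2a+1 = p≡3[4]⇒n-odd p%4≡3
    open Patterns (n-odd⇒−1∉QR (p / 4) n≡2a+1)
    F≢G = n-odd⇒Σclasses≢ (p / 4) n≡2a+1

  S-shift-invariant : ∀ b b′ v → InSet p (+ 1) b v → InSet p (+ 1) b′ v
  S-shift-invariant b b′ v v∈S with InSet⇒ {true} v∈S
  ... | k , 1<k , k<p , QRk , Nk≡v =
    subst (InSet p (+ 1) b′) (trans (N-shift-invariant (b′ %ℕ p) (b %ℕ p) 1<k k<p QRk) Nk≡v) (⇒InSet b′ 1<k k<p QRk)

theorem1p1 : (p : ℕ) → Prime p → p > 3 →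
    ((p % 4 ≡ 1 → ∀ (b : ℤ) → HasExactly1 (InSet p (+ 1) b) × HasExactly1 (InSet p -[1+ 0 ] b))
    × (p % 4 ≡ 3 → ∀ (b : ℤ) → HasExactly2 (InSet p (+ 1) b) × HasExactly2 (InSet p -[1+ 0 ] b))
    × (∀ (b b′ : ℤ) (n : ℕ) → (InSet p (+ 1) b n → InSet p (+ 1) b′ n) × (InSet p (+ 1) b′ n → InSet p (+ 1) b n)))
theorem1p1 zero    _       ()
theorem1p1 (suc q) p-prime p>3 =
  p≡1[4]⇒one-value , p≡3[4]⇒two-values , λ b b′ v → S-shift-invariant b b′ v , S-shift-invariant b′ b v
  where open OddPrime q p-prime p>3
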